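{- Let $M$ be a matroid on a finite linearly ordered set $E$, and let $p,q$ be non-negative integers. Then $$\frac{\partial^{p+q} t}{\partial x^p\partial y^q}(M;x,y)=p!q!\sum_{\substack{A\subseteq E\\ \iota_M(A)=p,\ nl_M(A)=q}}x^{cr_M(A)}y^{\epsilon_M(A)},$$ $$\frac{\partial^{p+q} t}{\partial x^p\partial y^q}(M;x,y)=p!q!\sum_{\substack{A\subseteq E\\ cr_M(A)=p,\ \epsilon_M(A)=q}}x^{\iota_M(A)}y^{nl_M(A)},$$ $$\frac{\partial^{p+q} t}{\partial x^p\partial y^q}(M;x,y)=p!q!\sum_{\substack{A\subseteq E\\ \iota_M(A)=p,\ \epsilon_M(A)=q}}x^{cr_M(A)}y^{nl_M(A)}.$$
   Context: $r_M$ is the rank function of $M$, $r(M)=r_M(E)$, and $t(M;x,y)=\sum_{A\subseteq E}(x-1)^{r(M)-r_M(A)}(y-1)^{|A|-r_M(A)}$. For $A\subseteq E$: $cr_M(A)=r(M)-r_M(A)$, $nl_M(A)=|A|-r_M(A)$; $\epsilon_M(A)$ is the number of $e\in E\setminus A$ that are the smallest element of some circuit of $M$ contained in $A\cup\{e\}$; $\iota_M(A)$ is the number of $e\in A$ that are the smallest element of some cocircuit of $M$ contained in $(E\setminus A)\cup\{e\}$. -}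

module Defs where

open import Data.Nat as ℕ using (ℕ; zero; suc; _≤_; _<_; _∸_; _!)
import Data.Nat.Properties as ℕP
open import Data.Integer as ℤ using (ℤ; +_)
open import Data.Fin as Fin using (Fin)
import Data.Fin.Properties as FinP
open import Data.Fin.Subset
  using (Subset; inside; outside; _∈_; _∉_; _⊆_; _⊂_; _∪_; _∩_; ∁; ⁅_⁆; ∣_∣; ⊤)
open import Data.Fin.Subset.Properties using (_∈?_; _⊆?_; _⊂?_; anySubset?)
open import Data.List as List using (List; []; _∷_; _++_; length; filter; allFin)
open import Data.Vec using ([]; _∷_)
open import Data.Product using (_×_; _,_; Σ)
open import Relation.Nullary using (Dec; yes; no; ¬_; ¬?; _×-dec_; _→-dec_)
open import Relation.Nullary.Decidable using (map′; decidable-stable)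
open import Level using (0ℓ)
open import Relation.Unary using (Pred; Decidable; Satisfiable)
open import Relation.Binary.PropositionalEquality using (_≡_)

-- Matroids on the ground set E = Fin n, linearly ordered by the usual
-- order of Fin n, given by their rank function (rank axioms R1-R3).

record Matroid (n : ℕ) : Set where
  field
    r        : Subset n → ℕ
    r-bound  : ∀ A → r A ≤ ∣ A ∣
    r-mono   : ∀ {A B} → A ⊆ B → r A ≤ r B
    r-submod : ∀ A B → r (A ∪ B) ℕ.+ r (A ∩ B) ≤ r A ℕ.+ r B

module _ {n : ℕ} where

  allSubset? : {P : Pred (Subset n) 0ℓ} → Decidable P → Dec (∀ D → P D)
  allSubset? {P} P? =
    map′ (λ h D → decidable-stable (P? D) (λ ¬p → h (D , ¬p)))
         (λ h (D , ¬p) → ¬p (h D))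
         (¬? (anySubset? (λ D → ¬? (P? D))))

  Dependent : (Subset n → ℕ) → Subset n → Set
  Dependent ρ C = ρ C < ∣ C ∣

  IsCircuit : (Subset n → ℕ) → Subset n → Set
  IsCircuit ρ C = Dependent ρ C × (∀ D → D ⊂ C → ¬ Dependent ρ D)

  isCircuit? : (ρ : Subset n → ℕ) → Decidable (IsCircuit ρ)
  isCircuit? ρ C = (ρ C ℕ.<? ∣ C ∣)
    ×-dec allSubset? (λ D → (D ⊂? C) →-dec ¬? (ρ D ℕ.<? ∣ D ∣))

  IsSmallest : Fin n → Subset n → Set
  IsSmallest e C = e ∈ C × (∀ f → f ∈ C → e Fin.≤ f)

  isSmallest? : ∀ e C → Dec (IsSmallest e C)
  isSmallest? e C = (e ∈? C) ×-dec FinP.all? (λ f → (f ∈? C) →-dec (e FinP.≤? f))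

  count : {P : Pred (Fin n) 0ℓ} → Decidable P → ℕ
  count P? = length (filter P? (allFin n))

module _ {n : ℕ} (M : Matroid n) where
  open Matroid M

  dualRank : Subset n → ℕ
  dualRank A = ∣ A ∣ ℕ.+ r (∁ A) ∸ r ⊤

  IsCocircuit : Subset n → Set
  IsCocircuit = IsCircuit dualRank

  rk : ℕ
  rk = r ⊤

  cr : Subset n → ℕ
  cr A = rk ∸ r A

  nl : Subset n → ℕ
  nl A = ∣ A ∣ ∸ r A

  ExtActive : Subset n → Fin n → Set
  ExtActive A e = e ∉ A × ∃⟨ (λ C → IsCircuit r C × C ⊆ A ∪ ⁅ e ⁆ × IsSmallest e C) ⟩

  IntActive : Subset n → Fin n → Set
  IntActive A e = e ∈ A × ∃⟨ (λ C → IsCocircuit C × C ⊆ ∁ A ∪ ⁅ e ⁆ × IsSmallest e C) ⟩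

  extActive? : ∀ A → Decidable (ExtActive A)
  extActive? A e = ¬? (e ∈? A) ×-dec anySubset?
    (λ C → isCircuit? r C ×-dec (C ⊆? A ∪ ⁅ e ⁆) ×-dec isSmallest? e C)

  intActive? : ∀ A → Decidable (IntActive A)
  intActive? A e = (e ∈? A) ×-dec anySubset?
    (λ C → isCircuit? dualRank C ×-dec (C ⊆? ∁ A ∪ ⁅ e ⁆) ×-dec isSmallest? e C)

  ε : Subset n → ℕ
  ε A = count (extActive? A)

  ι : Subset n → ℕ
  ι A = count (intActive? A)

-- Formal bivariate polynomials over ℤ in x, y, as coefficient functions:
-- P i j is the coefficient of x^i y^j.  (Only finitely supported ones
-- arise below.)  Equality is coefficientwise.

Poly : Set
Poly = ℕ → ℕ → ℤ

infix 4 _≈P_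
_≈P_ : Poly → Poly → Set
P ≈P Q = ∀ i j → P i j ≡ Q i j

Σ≤ : ℕ → (ℕ → ℤ) → ℤ
Σ≤ zero    f = f 0
Σ≤ (suc m) f = Σ≤ m f ℤ.+ f (suc m)

0P : Poly
0P _ _ = + 0

constP : ℤ → Poly
constP c zero zero = c
constP c _    _    = + 0

X Y : Poly
X (suc zero) zero = + 1
X _ _ = + 0
Y zero (suc zero) = + 1
Y _ _ = + 0

infixl 6 _+P_ _-P_
infixl 7 _*P_ _·P_
_+P_ _-P_ _*P_ : Poly → Poly → Poly
(P +P Q) i j = P i j ℤ.+ Q i j
(P -P Q) i j = P i j ℤ.- Q i j
(P *P Q) i j = Σ≤ i (λ a → Σ≤ j (λ b → P a b ℤ.* Q (i ∸ a) (j ∸ b)))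

_·P_ : ℤ → Poly → Poly
(c ·P P) i j = c ℤ.* P i j

infixr 8 _^P_
_^P_ : Poly → ℕ → Poly
P ^P zero  = constP (+ 1)
P ^P suc k = P *P (P ^P k)

sumP : List Poly → Poly
sumP = List.foldr _+P_ 0P

∂x ∂y : Poly → Poly
∂x P i j = + suc i ℤ.* P (suc i) j
∂y P i j = + suc j ℤ.* P i (suc j)

iter : ℕ → (Poly → Poly) → Poly → Poly
iter zero    f P = P
iter (suc k) f P = f (iter k f P)

∂^ : ℕ → ℕ → Poly → Poly
∂^ p q P = iter p ∂x (iter q ∂y P)

allSubsets : ∀ n → List (Subset n)
allSubsets zero    = [] ∷ []
allSubsets (suc n) = List.map (inside ∷_) (allSubsets n) ++ List.map (outside ∷_) (allSubsets n)

sumOver : ∀ {n} {P : Pred (Subset n) 0ℓ} → Decidable P → (Subset n → Poly) → Poly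
sumOver {n} P? f = sumP (List.map f (filter P? (allSubsets n)))

tutte : ∀ {n} → Matroid n → Poly
tutte {n} M = sumP (List.map (λ A → (X -P constP (+ 1)) ^P cr M A *P (Y -P constP (+ 1)) ^P nl M A) (allSubsets n))

module Submission where

-- For A ⊆ E consider the four statistics cr(A), nl(A), ι(A), ε(A).  The heart of the
-- proof is a refined count (count-formula): the number N(c, l, i, e) of subsets with
-- statistics (c, l, i, e) equals  bin(c, i) · bin(l, e) · T(c + i, l + e),  where
-- bin(a, b) = (a+b)!/(a! b!) and T(k, m) counts bases of internal activity k and
-- external activity m.  Tutte's theorem  [x^u y^v] t(M) = T(u, v)  (tutte-formula) is
-- proved alongside.  Both go by deletion–contraction of the largest element ℓ: the
-- activities are first characterised by ranks (ActivityByRank, via SmallestCircuit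
-- applied to M and to its dual), which shows that deleting or contracting ℓ leaves the
-- activities of the other elements unchanged (Minors); summing over subsets then splits
-- along ℓ (DeletionContraction).
--
-- Finally ∂^(p+q) t/∂x^p ∂y^q has coefficient  p! bin(i,p) · q! bin(j,q) · T(i+p, j+q)  at
-- x^i y^j, and each of the three sums in the theorem has coefficient p! q! times a count
-- N(·,·,·,·) with arguments permuted; derivative-formula compares the two.

open import Defs
open import Data.Nat as ℕ using (ℕ; zero; suc; _+_; _*_; _∸_; _≤_; _<_; z≤n; s≤s; _!; _≟_)
open import Data.Nat.Properties
open import Algebra.Properties.CommutativeSemigroup +-commutativeSemigroup using (interchange)
import Algebra.Properties.Monoid.Sum +-0-monoid as ℕΣ
open import Data.Nat.Tactic.RingSolver using (solve-∀)
open import Data.Integer as ℤ using (ℤ)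
import Data.Integer.Properties as ℤP
open import Data.Fin as Fin using (Fin; inject₁; fromℕ)
import Data.Fin.Properties as FinP
open import Data.Fin.Subset
open import Data.Fin.Subset.Properties
open import Data.Vec using ([]; _∷_; _∷ʳ_; here; there)
open import Data.Vec.Properties using (map-∷ʳ)
open import Data.Bool using (true; false; not; _∨_; _∧_)
open import Data.Bool.Properties using (∨-identityʳ; not-involutive)
open import Data.List as List using (List; []; _∷_; _++_; filter; length)
open import Data.Product using (_×_; _,_; ∃; proj₁; proj₂)
open import Data.Sum using (_⊎_; inj₁; inj₂)
open import Relation.Nullary using (Dec; yes; no; ¬_; ¬?; contradiction; _×-dec_; _→-dec_)
open import Relation.Unary using (Pred; Decidable)
open import Level using (0ℓ)
open import Function using (_∘_; id)
open import Relation.Binary.PropositionalEquality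

card-∪∩ : ∀ {n} (p q : Subset n) → ∣ p ∪ q ∣ + ∣ p ∩ q ∣ ≡ ∣ p ∣ + ∣ q ∣
card-∪∩ [] [] = refl
card-∪∩ (true ∷ p) (true ∷ q) = cong suc (trans (+-suc _ _) (trans (cong suc (card-∪∩ p q)) (sym (+-suc _ _))))
card-∪∩ (true ∷ p) (false ∷ q) = cong suc (card-∪∩ p q)
card-∪∩ (false ∷ p) (true ∷ q) = trans (cong suc (card-∪∩ p q)) (sym (+-suc _ _))
card-∪∩ (false ∷ p) (false ∷ q) = card-∪∩ p q

card-∪⁅⁆ : ∀ {n} (p : Subset n) (x : Fin n) → x ∉ p → ∣ p ∪ ⁅ x ⁆ ∣ ≡ suc ∣ p ∣
card-∪⁅⁆ (false ∷ p) Fin.zero x∉p = cong (suc ∘ ∣_∣) (∪-identityʳ p)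
card-∪⁅⁆ (true ∷ p) Fin.zero x∉p = contradiction here x∉p
card-∪⁅⁆ (true ∷ p) (Fin.suc x) x∉p = cong suc (card-∪⁅⁆ p x (x∉p ∘ there))
card-∪⁅⁆ (false ∷ p) (Fin.suc x) x∉p = card-∪⁅⁆ p x (x∉p ∘ there)

card-minus : ∀ {n} (p : Subset n) (x : Fin n) → x ∈ p → suc ∣ p - x ∣ ≡ ∣ p ∣
card-minus (true ∷ p) Fin.zero here = cong (suc ∘ ∣_∣) (p─⊥≡p p)
card-minus (true ∷ p) (Fin.suc x) (there x∈p) = cong suc (card-minus p x x∈p)
card-minus (false ∷ p) (Fin.suc x) (there x∈p) = card-minus p x x∈p

card-split : ∀ {n} (s t : Subset n) → s ⊆ t → ∣ s ∣ + ∣ t ─ s ∣ ≡ ∣ t ∣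
card-split [] [] _ = refl
card-split (true ∷ s) (true ∷ t) s⊆t = cong suc (card-split s t (drop-∷-⊆ s⊆t))
card-split (true ∷ s) (false ∷ t) s⊆t with s⊆t here
... | ()
card-split (false ∷ s) (true ∷ t) s⊆t = trans (+-suc _ _) (cong suc (card-split s t (drop-∷-⊆ s⊆t)))
card-split (false ∷ s) (false ∷ t) s⊆t = card-split s t (drop-∷-⊆ s⊆t)

∈-minus⁻ : ∀ {n} {p : Subset n} {x y : Fin n} → x ∈ p - y → x ∈ p × x ≢ y
∈-minus⁻ {p = p} {y = y} x∈p-y = p─q⊆p p ⁅ y ⁆ x∈p-y , λ { refl → not-removed x∈p-y (x∈⁅x⁆ y) }
  where
  not-removed : ∀ {n} {p q : Subset n} {x : Fin n} → x ∈ p ─ q → x ∉ q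
  not-removed {p = true ∷ p} {false ∷ q} {Fin.zero} here ()
  not-removed {p = _ ∷ p} {_ ∷ q} {Fin.suc x} (there h) (there h') = not-removed {p = p} {q} h h'

∈∪⁅⁆⁻ : ∀ {n} {p : Subset n} {x y : Fin n} → x ∈ p ∪ ⁅ y ⁆ → x ∈ p ⊎ x ≡ y
∈∪⁅⁆⁻ {p = p} {y = y} h with x∈p∪q⁻ p ⁅ y ⁆ h
... | inj₁ x∈p = inj₁ x∈p
... | inj₂ x∈⁅y⁆ = inj₂ (x∈⁅y⁆⇒x≡y y x∈⁅y⁆)

∈∪⁅⁆ˡ : ∀ {n} {p : Subset n} {x y : Fin n} → x ∈ p → x ∈ p ∪ ⁅ y ⁆
∈∪⁅⁆ˡ h = x∈p∪q⁺ (inj₁ h)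

∈∪⁅⁆ʳ : ∀ {n} {p : Subset n} (y : Fin n) → y ∈ p ∪ ⁅ y ⁆
∈∪⁅⁆ʳ y = x∈p∪q⁺ (inj₂ (x∈⁅x⁆ y))

module RankFacts {n : ℕ} (M : Matroid n) where
  open Matroid M

  -- S is independent when its size does not exceed (hence equals) its rank
  Independent : Subset n → Set
  Independent S = ∣ S ∣ ≤ r S

  rank-∅ : r ⊥ ≡ 0
  rank-∅ = n≤0⇒n≡0 (subst (r ⊥ ≤_) (∣⊥∣≡0 n) (r-bound ⊥))

  rank-∪ : ∀ S T → r (S ∪ T) ≤ r S + r T
  rank-∪ S T = ≤-trans (m≤m+n _ _) (r-submod S T)

  rank-∪⁅⁆ : ∀ S x → r (S ∪ ⁅ x ⁆) ≤ suc (r S)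
  rank-∪⁅⁆ S x = begin
    r (S ∪ ⁅ x ⁆)   ≤⟨ rank-∪ S ⁅ x ⁆ ⟩
    r S + r ⁅ x ⁆   ≤⟨ +-monoʳ-≤ (r S) (≤-trans (r-bound ⁅ x ⁆) (≤-reflexive (∣⁅x⁆∣≡1 x))) ⟩
    r S + 1         ≡⟨ +-comm (r S) 1 ⟩
    suc (r S)       ∎
    where open ≤-Reasoning

  rank-⊆∪⁅⁆ : ∀ {S T} x → S ⊆ T ∪ ⁅ x ⁆ → r S ≤ suc (r T)
  rank-⊆∪⁅⁆ {S} {T} x S⊆ = ≤-trans (r-mono S⊆) (rank-∪⁅⁆ T x)

  spans-mono : ∀ {S T} x → S ⊆ T → r (S ∪ ⁅ x ⁆) ≤ r S → r (T ∪ ⁅ x ⁆) ≤ r T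
  spans-mono {S} {T} x S⊆T x∈clS = +-cancelʳ-≤ (r S) _ _ (begin
      r (T ∪ ⁅ x ⁆) + r S                   ≤⟨ +-mono-≤ (r-mono ⊆₁) (r-mono ⊆₂) ⟩
      r ((S ∪ ⁅ x ⁆) ∪ T) + r ((S ∪ ⁅ x ⁆) ∩ T) ≤⟨ r-submod (S ∪ ⁅ x ⁆) T ⟩
      r (S ∪ ⁅ x ⁆) + r T                   ≤⟨ +-monoˡ-≤ (r T) x∈clS ⟩
      r S + r T                             ≡⟨ +-comm (r S) (r T) ⟩
      r T + r S                             ∎)
    where
    open ≤-Reasoning
    ⊆₁ : T ∪ ⁅ x ⁆ ⊆ (S ∪ ⁅ x ⁆) ∪ T
    ⊆₁ {z} h with ∈∪⁅⁆⁻ {p = T} h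
    ... | inj₁ z∈T = x∈p∪q⁺ (inj₂ z∈T)
    ... | inj₂ refl = x∈p∪q⁺ (inj₁ (∈∪⁅⁆ʳ {p = S} z))
    ⊆₂ : S ⊆ (S ∪ ⁅ x ⁆) ∩ T
    ⊆₂ h = x∈p∩q⁺ (∈∪⁅⁆ˡ h , S⊆T h)

  independent-⊆ : ∀ {S T} → S ⊆ T → Independent T → Independent S
  independent-⊆ {S} {T} S⊆T T-indep = +-cancelʳ-≤ ∣ T ─ S ∣ _ _ (begin
      ∣ S ∣ + ∣ T ─ S ∣   ≡⟨ card-split S T S⊆T ⟩
      ∣ T ∣               ≤⟨ T-indep ⟩
      r T                 ≤⟨ r-mono T⊆ ⟩
      r (S ∪ (T ─ S))     ≤⟨ rank-∪ S (T ─ S) ⟩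
      r S + r (T ─ S)     ≤⟨ +-monoʳ-≤ (r S) (r-bound (T ─ S)) ⟩
      r S + ∣ T ─ S ∣     ∎)
    where
    open ≤-Reasoning
    T⊆ : T ⊆ S ∪ (T ─ S)
    T⊆ {z} h with z ∈? S
    ... | yes z∈S = x∈p∪q⁺ (inj₁ z∈S)
    ... | no z∉S = x∈p∪q⁺ (inj₂ (x∈p∧x∉q⇒x∈p─q h z∉S))

  AllEssential : Subset n → Set
  AllEssential S = ∀ x → x ∈ S → r (S - x) < r S

  all-essential-minus : ∀ {S} x → AllEssential S → AllEssential (S - x)
  all-essential-minus {S} x ess y y∈S-x = +-cancelˡ-< (r S) _ _ (begin-strict
      r S + r (S - x - y)                  ≤⟨ +-mono-≤ (r-mono ⊆₁) (r-mono ⊆₂) ⟩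
      r ((S - y) ∪ (S - x)) + r ((S - y) ∩ (S - x)) ≤⟨ r-submod (S - y) (S - x) ⟩
      r (S - y) + r (S - x)                <⟨ +-monoˡ-< (r (S - x)) (ess y y∈S) ⟩
      r S + r (S - x)                      ∎)
    where
    open ≤-Reasoning
    y∈S : y ∈ S
    y∈S = proj₁ (∈-minus⁻ {p = S} y∈S-x)
    ⊆₁ : S ⊆ (S - y) ∪ (S - x)
    ⊆₁ {z} z∈S with z Fin.≟ y
    ... | yes refl = x∈p∪q⁺ (inj₂ y∈S-x)
    ... | no z≢y = x∈p∪q⁺ (inj₁ (x∈p∧x≢y⇒x∈p-y z∈S z≢y))
    ⊆₂ : S - x - y ⊆ (S - y) ∩ (S - x)
    ⊆₂ {z} h with ∈-minus⁻ {p = S - x} h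
    ... | z∈S-x , z≢y = x∈p∩q⁺ (x∈p∧x≢y⇒x∈p-y (proj₁ (∈-minus⁻ {p = S} z∈S-x)) z≢y , z∈S-x)

  all-essential⇒independent : ∀ k S → ∣ S ∣ ≡ k → AllEssential S → Independent S
  all-essential⇒independent zero S ∣S∣≡0 _ = subst (_≤ r S) (sym ∣S∣≡0) z≤n
  all-essential⇒independent (suc k) S ∣S∣≡1+k ess with nonempty? S
  ... | no empty = contradiction (trans (sym ∣S∣≡1+k) ∣S∣≡0) λ ()
    where
    ∣S∣≡0 : ∣ S ∣ ≡ 0
    ∣S∣≡0 = trans (cong ∣_∣ (Empty-unique empty)) (∣⊥∣≡0 n)
  ... | yes (x , x∈S) = subst₂ _≤_ (card-minus S x x∈S) (sym rS≡) (s≤s IH)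
    where
    IH : Independent (S - x)
    IH = all-essential⇒independent k (S - x)
           (suc-injective (trans (card-minus S x x∈S) ∣S∣≡1+k)) (all-essential-minus x ess)
    S⊆ : S ⊆ (S - x) ∪ ⁅ x ⁆
    S⊆ {z} z∈S with z Fin.≟ x
    ... | yes refl = ∈∪⁅⁆ʳ {p = S - x} x
    ... | no z≢x = ∈∪⁅⁆ˡ (x∈p∧x≢y⇒x∈p-y z∈S z≢x)
    rS≡ : r S ≡ suc (r (S - x))
    rS≡ = ≤-antisym (rank-⊆∪⁅⁆ x S⊆) (ess x x∈S)

  dependent⇒redundant : ∀ S → ¬ Independent S → ∃ λ x → x ∈ S × r (S - x) ≡ r S
  dependent⇒redundant S dep with FinP.¬∀⟶∃¬ n _ essential? (λ ess → dep (all-essential⇒independent _ S refl ess))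
    where
    essential? : Decidable (λ x → x ∈ S → r (S - x) < r S)
    essential? x = (x ∈? S) →-dec (r (S - x) ℕ.<? r S)
  ... | x , ¬ess with x ∈? S
  ... | no x∉S = contradiction (λ x∈S → contradiction x∈S x∉S) ¬ess
  ... | yes x∈S = x , x∈S , ≤-antisym (r-mono (p─q⊆p S ⁅ x ⁆)) (≮⇒≥ (λ lt → ¬ess (λ _ → lt)))

∸-+-distrib : ∀ k x y → k ≤ x → k ≤ y → (x ∸ k) + (y ∸ k) ≡ (x + y) ∸ (k + k)
∸-+-distrib zero x y _ _ = refl
∸-+-distrib (suc k) (suc x) (suc y) (s≤s k≤x) (s≤s k≤y)
  rewrite +-suc x y | +-suc k k = ∸-+-distrib k x y k≤x k≤y

-- The dual matroid, with rank function  r*(S) = |S| + r(E∖S) - r(E)  (Defs.dualRank).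
-- Cocircuits are the circuits of the dual, so internal activity is external activity of M*.

module Dual {n : ℕ} (M : Matroid n) where
  open Matroid M
  open RankFacts M

  δ : Subset n → ℕ
  δ S = ∣ S ∣ + r (∁ S)

  -- r(E) ≤ δ S, so that subtracting r(E) loses nothing
  rk≤δ : ∀ S → rk M ≤ δ S
  rk≤δ S = begin
    r ⊤               ≡⟨ cong r (sym (p∪∁p≡⊤ S)) ⟩
    r (S ∪ ∁ S)       ≤⟨ rank-∪ S (∁ S) ⟩
    r S + r (∁ S)     ≤⟨ +-monoˡ-≤ (r (∁ S)) (r-bound S) ⟩
    δ S               ∎
    where open ≤-Reasoning

  -- δ is monotone: enlarging S by d elements shrinks r(E∖S) by at most d
  δ-mono : ∀ {S T} → S ⊆ T → δ S ≤ δ T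
  δ-mono {S} {T} S⊆T = +-cancelʳ-≤ d _ _ (begin
      ∣ S ∣ + r (∁ S) + d               ≤⟨ +-monoˡ-≤ d (+-monoʳ-≤ ∣ S ∣ rank-∁S) ⟩
      ∣ S ∣ + (r (∁ T) + d) + d         ≡⟨ regroup ∣ S ∣ (r (∁ T)) d ⟩
      (∣ S ∣ + d) + r (∁ T) + d         ≡⟨ cong (λ m → m + r (∁ T) + d) (card-split S T S⊆T) ⟩
      δ T + d                           ∎)
    where
    open ≤-Reasoning
    d : ℕ
    d = ∣ T ─ S ∣
    regroup : ∀ a b c → a + (b + c) + c ≡ (a + c) + b + c
    regroup = solve-∀
    ∁S⊆ : ∁ S ⊆ ∁ T ∪ (T ─ S)
    ∁S⊆ {g} h with g ∈? T
    ... | yes g∈T = x∈p∪q⁺ (inj₂ (x∈p∧x∉q⇒x∈p─q g∈T (x∈∁p⇒x∉p h)))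
    ... | no g∉T = x∈p∪q⁺ (inj₁ (x∉p⇒x∈∁p g∉T))
    rank-∁S : r (∁ S) ≤ r (∁ T) + d
    rank-∁S = ≤-trans (r-mono ∁S⊆) (≤-trans (rank-∪ (∁ T) (T ─ S)) (+-monoʳ-≤ (r (∁ T)) (r-bound (T ─ S))))

  -- δ is submodular: inclusion–exclusion for |·| plus submodularity of r on complements
  δ-submod : ∀ S T → δ (S ∪ T) + δ (S ∩ T) ≤ δ S + δ T
  δ-submod S T = begin
    (∣ S ∪ T ∣ + r (∁ (S ∪ T))) + (∣ S ∩ T ∣ + r (∁ (S ∩ T))) ≡⟨ interchange ∣ S ∪ T ∣ _ _ _ ⟩
    (∣ S ∪ T ∣ + ∣ S ∩ T ∣) + (r (∁ (S ∪ T)) + r (∁ (S ∩ T))) ≤⟨ +-mono-≤ (≤-reflexive (card-∪∩ S T)) rank-∁ ⟩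
    (∣ S ∣ + ∣ T ∣) + (r (∁ S) + r (∁ T))                     ≡⟨ interchange ∣ S ∣ _ _ _ ⟩
    (∣ S ∣ + r (∁ S)) + (∣ T ∣ + r (∁ T))                     ∎
    where
    open ≤-Reasoning
    ∁∪⊆ : ∁ (S ∪ T) ⊆ ∁ S ∩ ∁ T
    ∁∪⊆ h = x∈p∩q⁺ ( x∉p⇒x∈∁p (λ a → x∈∁p⇒x∉p h (x∈p∪q⁺ (inj₁ a)))
                   , x∉p⇒x∈∁p (λ b → x∈∁p⇒x∉p h (x∈p∪q⁺ (inj₂ b))))
    ∁∩⊆ : ∁ (S ∩ T) ⊆ ∁ S ∪ ∁ T
    ∁∩⊆ {g} h with g ∈? S | g ∈? T
    ... | yes a | yes b = contradiction (x∈p∩q⁺ (a , b)) (x∈∁p⇒x∉p h)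
    ... | no a | _ = x∈p∪q⁺ (inj₁ (x∉p⇒x∈∁p a))
    ... | _ | no b = x∈p∪q⁺ (inj₂ (x∉p⇒x∈∁p b))
    rank-∁ : r (∁ (S ∪ T)) + r (∁ (S ∩ T)) ≤ r (∁ S) + r (∁ T)
    rank-∁ = ≤-trans (≤-reflexive (+-comm (r (∁ (S ∪ T))) _))
               (≤-trans (+-mono-≤ (r-mono ∁∩⊆) (r-mono ∁∪⊆)) (r-submod (∁ S) (∁ T)))

  dualM : Matroid n
  dualM = record
    { r = dualRank M
    ; r-bound = λ S → ≤-trans (∸-monoˡ-≤ (rk M) (+-monoʳ-≤ ∣ S ∣ (r-mono ⊆⊤)))
                              (≤-reflexive (m+n∸n≡m ∣ S ∣ (rk M)))
    ; r-mono = λ S⊆T → ∸-monoˡ-≤ (rk M) (δ-mono S⊆T)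
    ; r-submod = λ S T → begin
        (δ (S ∪ T) ∸ rk M) + (δ (S ∩ T) ∸ rk M) ≡⟨ ∸-+-distrib (rk M) _ _ (rk≤δ (S ∪ T)) (rk≤δ (S ∩ T)) ⟩
        (δ (S ∪ T) + δ (S ∩ T)) ∸ (rk M + rk M) ≤⟨ ∸-monoˡ-≤ (rk M + rk M) (δ-submod S T) ⟩
        (δ S + δ T) ∸ (rk M + rk M)             ≡⟨ sym (∸-+-distrib (rk M) _ _ (rk≤δ S) (rk≤δ T)) ⟩
        (δ S ∸ rk M) + (δ T ∸ rk M)             ∎
    }
    where open ≤-Reasoning

above : ∀ {n} → Fin n → Subset n → Subset n
above Fin.zero (_ ∷ p) = outside ∷ p
above (Fin.suc f) (_ ∷ p) = outside ∷ above f p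

above-∈⁻ : ∀ {n} (f : Fin n) (p : Subset n) {g} → g ∈ above f p → g ∈ p × f Fin.< g
above-∈⁻ Fin.zero (_ ∷ p) (there h) = there h , s≤s z≤n
above-∈⁻ (Fin.suc f) (_ ∷ p) (there h) with above-∈⁻ f p h
... | g∈p , f<g = there g∈p , s≤s f<g

above-∈⁺ : ∀ {n} (f : Fin n) (p : Subset n) {g} → g ∈ p → f Fin.< g → g ∈ above f p
above-∈⁺ Fin.zero (_ ∷ p) (there h) _ = there h
above-∈⁺ (Fin.suc f) (_ ∷ p) (there h) (s≤s f<g) = there (above-∈⁺ f p h f<g)

minimal-subset : ∀ {n} {Q : Pred (Subset n) 0ℓ} → Decidable Q → ∀ k D → ∣ D ∣ ≤ k → Q D →
  ∃ λ D′ → D′ ⊆ D × Q D′ × (∀ S → S ⊂ D′ → ¬ Q S)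
minimal-subset Q? zero D ∣D∣≤0 qD =
  D , id , qD , λ S S⊂D _ → contradiction (≤-trans (p⊂q⇒∣p∣<∣q∣ S⊂D) ∣D∣≤0) λ ()
minimal-subset Q? (suc k) D ∣D∣≤k qD with anySubset? (λ S → (S ⊂? D) ×-dec Q? S)
... | no none = D , id , qD , λ S S⊂D qS → none (S , S⊂D , qS)
... | yes (S , S⊂D , qS) with minimal-subset Q? k S (≤-pred (≤-trans (p⊂q⇒∣p∣<∣q∣ S⊂D) ∣D∣≤k)) qS
...   | D′ , D′⊆S , qD′ , min = D′ , proj₁ S⊂D ∘ D′⊆S , qD′ , min

-- Rank criterion for "e is the smallest element of a circuit contained in Z ∪ {e}":
-- such a circuit exists iff e lies in the closure of the elements of Z above e.
-- Applied to M (with Z = A) it characterises external activity; applied to the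
-- dual matroid (with Z = E∖A) it characterises internal activity.

module SmallestCircuit {n : ℕ} (M : Matroid n) (Z : Subset n) (e : Fin n) where
  open Matroid M
  open RankFacts M

  Z⁺ : Subset n
  Z⁺ = above e Z

  CircuitAt : Set
  CircuitAt = ∃ λ C → IsCircuit r C × C ⊆ Z ∪ ⁅ e ⁆ × IsSmallest e C

  Spans : Pred (Subset n) 0ℓ
  Spans D = r (D ∪ ⁅ e ⁆) ≤ r D

  e∉Z⁺ : e ∉ Z⁺
  e∉Z⁺ e∈Z⁺ = FinP.<-irrefl refl (proj₂ (above-∈⁻ e Z e∈Z⁺))

  -- for such a circuit C, C - e is independent, so it spans e; as C - e ⊆ Z⁺, so does Z⁺
  circuit⇒spanned : CircuitAt → r (Z⁺ ∪ ⁅ e ⁆) ≡ r Z⁺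
  circuit⇒spanned (C , (dep , minimal) , C⊆ , e∈C , smallest) =
    ≤-antisym (spans-mono e C-e⊆Z⁺ C-e-spans) (r-mono (∈∪⁅⁆ˡ {p = Z⁺}))
    where
    C-e⊆Z⁺ : C - e ⊆ Z⁺
    C-e⊆Z⁺ {g} h with ∈-minus⁻ {p = C} h
    ... | g∈C , g≢e with ∈∪⁅⁆⁻ {p = Z} (C⊆ g∈C)
    ...   | inj₂ g≡e = contradiction g≡e g≢e
    ...   | inj₁ g∈Z = above-∈⁺ e Z g∈Z (FinP.≤∧≢⇒< (smallest g g∈C) (g≢e ∘ sym))
    C-e-indep : Independent (C - e)
    C-e-indep = ≮⇒≥ (minimal (C - e) (x∈p⇒p-x⊂p e∈C))
    rC≤ : r C ≤ r (C - e)
    rC≤ = ≤-pred (≤-trans dep (subst (_≤ suc (r (C - e))) (card-minus C e e∈C) (s≤s C-e-indep)))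
    C-e-spans : Spans (C - e)
    C-e-spans = ≤-trans (r-mono ⊆C) rC≤
      where
      ⊆C : (C - e) ∪ ⁅ e ⁆ ⊆ C
      ⊆C {g} h with ∈∪⁅⁆⁻ {p = C - e} h
      ... | inj₁ g∈C-e = proj₁ (∈-minus⁻ {p = C} g∈C-e)
      ... | inj₂ refl = e∈C

  -- a minimal subset D of Z⁺ spanning e is independent, and D ∪ {e} is the wanted circuit
  module MinimalSpanning (D : Subset n) (D⊆Z⁺ : D ⊆ Z⁺) (D-spans : Spans D)
                         (minimal : ∀ S → S ⊂ D → ¬ Spans S) where

    e∉D : e ∉ D
    e∉D = e∉Z⁺ ∘ D⊆Z⁺

    D-indep : Independent D
    D-indep with ∣ D ∣ ℕ.≤? r D
    ... | yes indep = indep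
    ... | no dep with dependent⇒redundant D dep
    ...   | d , d∈D , rD-d≡rD = contradiction D-d-spans (minimal (D - d) (x∈p⇒p-x⊂p d∈D))
      where
      ⊆D∪e : (D - d) ∪ ⁅ e ⁆ ⊆ D ∪ ⁅ e ⁆
      ⊆D∪e {g} h with ∈∪⁅⁆⁻ {p = D - d} h
      ... | inj₁ g∈D-d = ∈∪⁅⁆ˡ (proj₁ (∈-minus⁻ {p = D} g∈D-d))
      ... | inj₂ refl = ∈∪⁅⁆ʳ {p = D} e
      D-d-spans : Spans (D - d)
      D-d-spans = ≤-trans (r-mono ⊆D∪e) (≤-trans D-spans (≤-reflexive (sym rD-d≡rD)))

    C : Subset n
    C = D ∪ ⁅ e ⁆

    C-dependent : Dependent r C
    C-dependent = subst (suc (r C) ≤_) (sym (card-∪⁅⁆ D e e∉D)) (s≤s (≤-trans D-spans (r-bound D)))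

    -- removing c ≠ e from C leaves (D - c) ∪ {e}, independent since D - c does not span e
    C-minus-indep : ∀ c → c ∈ D → Independent ((D - c) ∪ ⁅ e ⁆)
    C-minus-indep c c∈D = subst (_≤ r ((D - c) ∪ ⁅ e ⁆)) (sym card≡) (≤-trans (s≤s D-c-indep) grows)
      where
      D-c⊆D : D - c ⊆ D
      D-c⊆D h = proj₁ (∈-minus⁻ {p = D} h)
      D-c-indep : Independent (D - c)
      D-c-indep = independent-⊆ D-c⊆D D-indep
      grows : r (D - c) < r ((D - c) ∪ ⁅ e ⁆)
      grows = ≰⇒> (minimal (D - c) (x∈p⇒p-x⊂p c∈D))
      card≡ : ∣ (D - c) ∪ ⁅ e ⁆ ∣ ≡ suc ∣ D - c ∣
      card≡ = card-∪⁅⁆ (D - c) e (e∉D ∘ D-c⊆D)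

    C-minimal : ∀ S → S ⊂ C → ¬ Dependent r S
    C-minimal S (S⊆C , c , c∈C , c∉S) = ≤⇒≯ S-indep
      where
      S-indep : Independent S
      S-indep with c Fin.≟ e
      ... | yes refl = independent-⊆ S⊆D D-indep
        where
        S⊆D : S ⊆ D
        S⊆D {g} g∈S with ∈∪⁅⁆⁻ {p = D} (S⊆C g∈S)
        ... | inj₁ g∈D = g∈D
        ... | inj₂ refl = contradiction g∈S c∉S
      ... | no c≢e = independent-⊆ S⊆ (C-minus-indep c c∈D)
        where
        c∈D : c ∈ D
        c∈D with ∈∪⁅⁆⁻ {p = D} c∈C
        ... | inj₁ c∈D = c∈D
        ... | inj₂ c≡e = contradiction c≡e c≢e
        S⊆ : S ⊆ (D - c) ∪ ⁅ e ⁆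
        S⊆ {g} g∈S with ∈∪⁅⁆⁻ {p = D} (S⊆C g∈S)
        ... | inj₂ refl = ∈∪⁅⁆ʳ {p = D - c} e
        ... | inj₁ g∈D with g Fin.≟ c
        ...   | yes refl = contradiction g∈S c∉S
        ...   | no g≢c = ∈∪⁅⁆ˡ (x∈p∧x≢y⇒x∈p-y g∈D g≢c)

    circuit : CircuitAt
    circuit = C , (C-dependent , C-minimal) , C⊆ , ∈∪⁅⁆ʳ {p = D} e , smallest
      where
      C⊆ : C ⊆ Z ∪ ⁅ e ⁆
      C⊆ {g} h with ∈∪⁅⁆⁻ {p = D} h
      ... | inj₁ g∈D = ∈∪⁅⁆ˡ (proj₁ (above-∈⁻ e Z (D⊆Z⁺ g∈D)))
      ... | inj₂ refl = ∈∪⁅⁆ʳ {p = Z} e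
      smallest : ∀ f → f ∈ C → e Fin.≤ f
      smallest f h with ∈∪⁅⁆⁻ {p = D} h
      ... | inj₁ f∈D = <⇒≤ (proj₂ (above-∈⁻ e Z (D⊆Z⁺ f∈D)))
      ... | inj₂ refl = FinP.≤-refl

  spanned⇒circuit : r (Z⁺ ∪ ⁅ e ⁆) ≡ r Z⁺ → CircuitAt
  spanned⇒circuit Z⁺-spans
    with minimal-subset (λ D → r (D ∪ ⁅ e ⁆) ℕ.≤? r D) ∣ Z⁺ ∣ Z⁺ ≤-refl (≤-reflexive Z⁺-spans)
  ... | D , D⊆Z⁺ , D-spans , minimal = MinimalSpanning.circuit D D⊆Z⁺ D-spans minimal

-- With A⁺ = above e A and
-- A⁻ = E minus the elements of E∖A above e:
--   e externally active  ⟺  e ∉ A  and  r(A⁺ ∪ {e}) = r(A⁺)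
--   e internally active  ⟺  e ∈ A  and  r(A⁻ ∖ {e}) + 1 = r(A⁻)

module ActivityByRank {n : ℕ} (M : Matroid n) where
  open Matroid M
  open Dual M

  ExtActiveR : Subset n → Fin n → Set
  ExtActiveR A e = e ∉ A × r (above e A ∪ ⁅ e ⁆) ≡ r (above e A)

  IntActiveR : Subset n → Fin n → Set
  IntActiveR A e = e ∈ A × suc (r (∁ (above e (∁ A) ∪ ⁅ e ⁆))) ≡ r (∁ (above e (∁ A)))

  extActiveR? : ∀ A → Decidable (ExtActiveR A)
  extActiveR? A e = ¬? (e ∈? A) ×-dec (r (above e A ∪ ⁅ e ⁆) ℕ.≟ r (above e A))

  intActiveR? : ∀ A → Decidable (IntActiveR A)
  intActiveR? A e = (e ∈? A) ×-dec (suc (r (∁ (above e (∁ A) ∪ ⁅ e ⁆))) ℕ.≟ r (∁ (above e (∁ A))))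

  ext⇒R : ∀ A e → ExtActive M A e → ExtActiveR A e
  ext⇒R A e (e∉A , circuit) = e∉A , SmallestCircuit.circuit⇒spanned M A e circuit

  R⇒ext : ∀ A e → ExtActiveR A e → ExtActive M A e
  R⇒ext A e (e∉A , spanned) = e∉A , SmallestCircuit.spanned⇒circuit M A e spanned

  -- in the dual, "W ∪ {e} has the same rank as W" means "e is a coloop of E∖W"
  module _ (A : Subset n) (e : Fin n) where
    private
      W : Subset n
      W = above e (∁ A)
      ∣W∪e∣ : ∣ W ∪ ⁅ e ⁆ ∣ ≡ suc ∣ W ∣
      ∣W∪e∣ = card-∪⁅⁆ W e (SmallestCircuit.e∉Z⁺ M (∁ A) e)

    dual-spans⇒coloop : dualRank M (W ∪ ⁅ e ⁆) ≡ dualRank M W → suc (r (∁ (W ∪ ⁅ e ⁆))) ≡ r (∁ W)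
    dual-spans⇒coloop eq = +-cancelˡ-≡ ∣ W ∣ _ _ (begin
      (∣ W ∣) + suc (r (∁ (W ∪ ⁅ e ⁆)))   ≡⟨ +-suc ∣ W ∣ _ ⟩
      (suc ∣ W ∣) + r (∁ (W ∪ ⁅ e ⁆))     ≡⟨ cong (_+ r (∁ (W ∪ ⁅ e ⁆))) (sym ∣W∪e∣) ⟩
      δ (W ∪ ⁅ e ⁆)                     ≡⟨ ∸-cancelʳ-≡ (rk≤δ (W ∪ ⁅ e ⁆)) (rk≤δ W) eq ⟩
      δ W                               ∎)
      where open ≡-Reasoning

    coloop⇒dual-spans : suc (r (∁ (W ∪ ⁅ e ⁆))) ≡ r (∁ W) → dualRank M (W ∪ ⁅ e ⁆) ≡ dualRank M W
    coloop⇒dual-spans eq = cong (_∸ rk M) (begin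
      (∣ W ∪ ⁅ e ⁆ ∣) + r (∁ (W ∪ ⁅ e ⁆)) ≡⟨ cong (_+ r (∁ (W ∪ ⁅ e ⁆))) ∣W∪e∣ ⟩
      (suc ∣ W ∣) + r (∁ (W ∪ ⁅ e ⁆))     ≡⟨ sym (+-suc ∣ W ∣ _) ⟩
      (∣ W ∣) + suc (r (∁ (W ∪ ⁅ e ⁆)))   ≡⟨ cong (λ m → ∣ W ∣ + m) eq ⟩
      δ W                               ∎)
      where open ≡-Reasoning

  int⇒R : ∀ A e → IntActive M A e → IntActiveR A e
  int⇒R A e (e∈A , cocircuit) =
    e∈A , dual-spans⇒coloop A e (SmallestCircuit.circuit⇒spanned dualM (∁ A) e cocircuit)

  R⇒int : ∀ A e → IntActiveR A e → IntActive M A e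
  R⇒int A e (e∈A , coloop) =
    e∈A , SmallestCircuit.spanned⇒circuit dualM (∁ A) e (coloop⇒dual-spans A e coloop)

indicator : ∀ {P : Set} → Dec P → ℕ
indicator (yes _) = 1
indicator (no _) = 0

indicator-cong : ∀ {P Q : Set} → (P → Q) → (Q → P) → (p : Dec P) (q : Dec Q) → indicator p ≡ indicator q
indicator-cong f g (yes p) (yes q) = refl
indicator-cong f g (yes p) (no ¬q) = contradiction (f p) ¬q
indicator-cong f g (no ¬p) (yes q) = contradiction (g q) ¬p
indicator-cong f g (no ¬p) (no ¬q) = refl

indicator-no : ∀ {P : Set} → ¬ P → (p : Dec P) → indicator p ≡ 0
indicator-no ¬p (yes p) = contradiction p ¬p
indicator-no ¬p (no _) = refl

count≡sum : ∀ {n} {P : Pred (Fin n) 0ℓ} (P? : Decidable P) → count P? ≡ ℕΣ.sum (λ e → indicator (P? e))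
count≡sum {n} P? = go n id
  where
  go : ∀ m (g : Fin m → Fin n) → length (filter P? (List.tabulate g)) ≡ ℕΣ.sum (λ i → indicator (P? (g i)))
  go zero g = refl
  go (suc m) g with P? (g Fin.zero)
  ... | yes _ = cong suc (go m (g ∘ Fin.suc))
  ... | no _ = go m (g ∘ Fin.suc)

count-cong : ∀ {n} {P Q : Pred (Fin n) 0ℓ} (P? : Decidable P) (Q? : Decidable Q) →
  (∀ e → P e → Q e) → (∀ e → Q e → P e) → count P? ≡ count Q?
count-cong P? Q? f g = begin
  count P?                          ≡⟨ count≡sum P? ⟩
  ℕΣ.sum (λ e → indicator (P? e))   ≡⟨ ℕΣ.sum-cong-≗ (λ e → indicator-cong (f e) (g e) (P? e) (Q? e)) ⟩
  ℕΣ.sum (λ e → indicator (Q? e))   ≡⟨ sym (count≡sum Q?) ⟩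
  count Q?                          ∎
  where open ≡-Reasoning

count-last : ∀ {n} {P : Pred (Fin (suc n)) 0ℓ} (P? : Decidable P) →
  count P? ≡ count (λ e → P? (inject₁ e)) + indicator (P? (fromℕ n))
count-last {n} P? = begin
  count P?
    ≡⟨ count≡sum P? ⟩
  ℕΣ.sum (λ e → indicator (P? e))
    ≡⟨ ℕΣ.sum-init-last (λ e → indicator (P? e)) ⟩
  ℕΣ.sum (λ e → indicator (P? (inject₁ e))) + indicator (P? (fromℕ n))
    ≡⟨ cong (_+ indicator (P? (fromℕ n))) (sym (count≡sum (λ e → P? (inject₁ e)))) ⟩
  count (λ e → P? (inject₁ e)) + indicator (P? (fromℕ n)) ∎
  where open ≡-Reasoning

count-last-cong : ∀ {n} {P : Pred (Fin (suc n)) 0ℓ} {Q : Pred (Fin n) 0ℓ} {L : Set}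
  (P? : Decidable P) (Q? : Decidable Q) (L? : Dec L) →
  (∀ f → P (inject₁ f) → Q f) → (∀ f → Q f → P (inject₁ f)) →
  (P (fromℕ n) → L) → (L → P (fromℕ n)) →
  count P? ≡ count Q? + indicator L?
count-last-cong {n} P? Q? L? below⇒ ⇒below last⇒ ⇒last =
  trans (count-last P?)
        (cong₂ _+_ (count-cong (λ f → P? (inject₁ f)) Q? below⇒ ⇒below)
                   (indicator-cong last⇒ ⇒last (P? (fromℕ n)) L?))

count-last-cong₀ : ∀ {n} {P : Pred (Fin (suc n)) 0ℓ} {Q : Pred (Fin n) 0ℓ}
  (P? : Decidable P) (Q? : Decidable Q) →
  (∀ f → P (inject₁ f) → Q f) → (∀ f → Q f → P (inject₁ f)) → ¬ P (fromℕ n) →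
  count P? ≡ count Q?
count-last-cong₀ {n} P? Q? below⇒ ⇒below ¬last =
  trans (count-last-cong P? Q? (P? (fromℕ n)) below⇒ ⇒below id id)
        (trans (cong (λ m → count Q? + m) (indicator-no ¬last (P? (fromℕ n)))) (+-identityʳ _))

module ActivityCount {n : ℕ} (M : Matroid n) where
  open ActivityByRank M

  ε≡ : ∀ A → ε M A ≡ count (extActiveR? A)
  ε≡ A = count-cong (extActive? M A) (extActiveR? A) (ext⇒R A) (R⇒ext A)

  ι≡ : ∀ A → ι M A ≡ count (intActiveR? A)
  ι≡ A = count-cong (intActive? M A) (intActiveR? A) (int⇒R A) (R⇒int A)

same-rank⇒same-statistics : ∀ {n} (M₁ M₂ : Matroid n) → (∀ S → Matroid.r M₁ S ≡ Matroid.r M₂ S) → ∀ A →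
  cr M₁ A ≡ cr M₂ A × nl M₁ A ≡ nl M₂ A × ι M₁ A ≡ ι M₂ A × ε M₁ A ≡ ε M₂ A
same-rank⇒same-statistics M₁ M₂ r≡ A =
  cong₂ _∸_ (r≡ ⊤) (r≡ A) ,
  cong (∣ A ∣ ∸_) (r≡ A) ,
  trans (C₁.ι≡ A) (trans (count-cong (R₁.intActiveR? A) (R₂.intActiveR? A) int₁⇒₂ int₂⇒₁) (sym (C₂.ι≡ A))) ,
  trans (C₁.ε≡ A) (trans (count-cong (R₁.extActiveR? A) (R₂.extActiveR? A) ext₁⇒₂ ext₂⇒₁) (sym (C₂.ε≡ A)))
  where
  module R₁ = ActivityByRank M₁
  module R₂ = ActivityByRank M₂
  module C₁ = ActivityCount M₁
  module C₂ = ActivityCount M₂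
  int₁⇒₂ : ∀ e → R₁.IntActiveR A e → R₂.IntActiveR A e
  int₁⇒₂ e (e∈A , eq) = e∈A , trans (cong suc (sym (r≡ _))) (trans eq (r≡ _))
  int₂⇒₁ : ∀ e → R₂.IntActiveR A e → R₁.IntActiveR A e
  int₂⇒₁ e (e∈A , eq) = e∈A , trans (cong suc (r≡ _)) (trans eq (sym (r≡ _)))
  ext₁⇒₂ : ∀ e → R₁.ExtActiveR A e → R₂.ExtActiveR A e
  ext₁⇒₂ e (e∉A , eq) = e∉A , trans (sym (r≡ _)) (trans eq (r≡ _))
  ext₂⇒₁ : ∀ e → R₂.ExtActiveR A e → R₁.ExtActiveR A e
  ext₂⇒₁ e (e∉A , eq) = e∉A , trans (r≡ _) (trans eq (sym (r≡ _)))

-- Subsets of Fin (suc n) written as  S ∷ʳ b : S ⊆ Fin n plus a bit for the largest element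

∪-∷ʳ : ∀ {n} (S T : Subset n) a b → (S ∷ʳ a) ∪ (T ∷ʳ b) ≡ (S ∪ T) ∷ʳ (a ∨ b)
∪-∷ʳ [] [] a b = refl
∪-∷ʳ (x ∷ S) (y ∷ T) a b = cong ((x ∨ y) ∷_) (∪-∷ʳ S T a b)

∩-∷ʳ : ∀ {n} (S T : Subset n) a b → (S ∷ʳ a) ∩ (T ∷ʳ b) ≡ (S ∩ T) ∷ʳ (a ∧ b)
∩-∷ʳ [] [] a b = refl
∩-∷ʳ (x ∷ S) (y ∷ T) a b = cong ((x ∧ y) ∷_) (∩-∷ʳ S T a b)

⊤-∷ʳ : ∀ n → ⊤ {suc n} ≡ ⊤ {n} ∷ʳ true
⊤-∷ʳ zero = refl
⊤-∷ʳ (suc n) = cong (true ∷_) (⊤-∷ʳ n)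

⊥-∷ʳ : ∀ n → ⊥ {suc n} ≡ ⊥ {n} ∷ʳ false
⊥-∷ʳ zero = refl
⊥-∷ʳ (suc n) = cong (false ∷_) (⊥-∷ʳ n)

∁⊥≡⊤ : ∀ n → ∁ (⊥ {n}) ≡ ⊤
∁⊥≡⊤ zero = refl
∁⊥≡⊤ (suc n) = cong (true ∷_) (∁⊥≡⊤ n)

⁅inject₁⁆ : ∀ {n} (f : Fin n) → ⁅ inject₁ f ⁆ ≡ ⁅ f ⁆ ∷ʳ false
⁅inject₁⁆ {suc n} Fin.zero = cong (true ∷_) (⊥-∷ʳ n)
⁅inject₁⁆ (Fin.suc f) = cong (false ∷_) (⁅inject₁⁆ f)

⁅fromℕ⁆ : ∀ n → ⁅ fromℕ n ⁆ ≡ ⊥ ∷ʳ true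
⁅fromℕ⁆ zero = refl
⁅fromℕ⁆ (suc n) = cong (false ∷_) (⁅fromℕ⁆ n)

above-inject₁ : ∀ {n} (f : Fin n) (S : Subset n) b → above (inject₁ f) (S ∷ʳ b) ≡ above f S ∷ʳ b
above-inject₁ Fin.zero (x ∷ S) b = refl
above-inject₁ (Fin.suc f) (x ∷ S) b = cong (false ∷_) (above-inject₁ f S b)

above-fromℕ : ∀ n (S : Subset (suc n)) → above (fromℕ n) S ≡ ⊥
above-fromℕ zero (x ∷ []) = refl
above-fromℕ (suc n) (x ∷ S) = cong (false ∷_) (above-fromℕ n S)

∣∷ʳfalse∣ : ∀ {n} (S : Subset n) → ∣ S ∷ʳ false ∣ ≡ ∣ S ∣
∣∷ʳfalse∣ [] = refl
∣∷ʳfalse∣ (true ∷ S) = cong suc (∣∷ʳfalse∣ S)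
∣∷ʳfalse∣ (false ∷ S) = ∣∷ʳfalse∣ S

∣∷ʳtrue∣ : ∀ {n} (S : Subset n) → ∣ S ∷ʳ true ∣ ≡ suc ∣ S ∣
∣∷ʳtrue∣ [] = refl
∣∷ʳtrue∣ (true ∷ S) = cong suc (∣∷ʳtrue∣ S)
∣∷ʳtrue∣ (false ∷ S) = ∣∷ʳtrue∣ S

inject₁-∈⁻ : ∀ {n} {S : Subset n} {b} (f : Fin n) → inject₁ f ∈ S ∷ʳ b → f ∈ S
inject₁-∈⁻ {S = true ∷ S} Fin.zero here = here
inject₁-∈⁻ {S = x ∷ S} (Fin.suc f) (there h) = there (inject₁-∈⁻ f h)

inject₁-∈⁺ : ∀ {n} {S : Subset n} {b} (f : Fin n) → f ∈ S → inject₁ f ∈ S ∷ʳ b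
inject₁-∈⁺ Fin.zero here = here
inject₁-∈⁺ (Fin.suc f) (there h) = there (inject₁-∈⁺ f h)

fromℕ-∈⁻ : ∀ {n} {S : Subset n} {b} → fromℕ n ∈ S ∷ʳ b → b ≡ true
fromℕ-∈⁻ {S = []} here = refl
fromℕ-∈⁻ {S = x ∷ S} (there h) = fromℕ-∈⁻ h

fromℕ-∈⁺ : ∀ {n} (S : Subset n) → fromℕ n ∈ S ∷ʳ true
fromℕ-∈⁺ [] = here
fromℕ-∈⁺ (x ∷ S) = there (fromℕ-∈⁺ S)

fromℕ-∉ : ∀ {n} (S : Subset n) → fromℕ n ∉ S ∷ʳ false
fromℕ-∉ S h with fromℕ-∈⁻ {S = S} h
... | ()

∷ʳ-⊆ : ∀ {n} {S T : Subset n} {a b} → S ⊆ T → (a ≡ true → b ≡ true) → S ∷ʳ a ⊆ T ∷ʳ b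
∷ʳ-⊆ {S = []} {[]} {true} h a⇒b here rewrite a⇒b refl = here
∷ʳ-⊆ {S = x ∷ S} {y ∷ T} h a⇒b {Fin.zero} here with h here
... | here = here
∷ʳ-⊆ {S = x ∷ S} {y ∷ T} h a⇒b {Fin.suc i} (there p) = there (∷ʳ-⊆ (drop-∷-⊆ h) a⇒b p)

ext-set-∷ʳ : ∀ {n} (S : Subset n) f b → above (inject₁ f) (S ∷ʳ b) ∪ ⁅ inject₁ f ⁆ ≡ (above f S ∪ ⁅ f ⁆) ∷ʳ b
ext-set-∷ʳ S f b rewrite above-inject₁ f S b | ⁅inject₁⁆ f | ∪-∷ʳ (above f S) ⁅ f ⁆ b false | ∨-identityʳ b = refl

int-set-∷ʳ : ∀ {n} (S : Subset n) f b → ∁ (above (inject₁ f) (∁ (S ∷ʳ b))) ≡ ∁ (above f (∁ S)) ∷ʳ b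
int-set-∷ʳ S f b rewrite map-∷ʳ not b S | above-inject₁ f (∁ S) (not b)
  | map-∷ʳ not (not b) (above f (∁ S)) | not-involutive b = refl

int-set′-∷ʳ : ∀ {n} (S : Subset n) f b →
  ∁ (above (inject₁ f) (∁ (S ∷ʳ b)) ∪ ⁅ inject₁ f ⁆) ≡ ∁ (above f (∁ S) ∪ ⁅ f ⁆) ∷ʳ b
int-set′-∷ʳ S f b rewrite map-∷ʳ not b S | above-inject₁ f (∁ S) (not b) | ⁅inject₁⁆ f
  | ∪-∷ʳ (above f (∁ S)) ⁅ f ⁆ (not b) false | ∨-identityʳ (not b)
  | map-∷ʳ not (not b) (above f (∁ S) ∪ ⁅ f ⁆) | not-involutive b = refl

-- Deletion M ∖ ℓ and contraction M / ℓ of the largest element ℓ = fromℕ n.  For A ⊆ E∖ℓ,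
-- the statistics (cr, nl, ι, ε) of A in M, resp. of A ∪ ℓ in M, are those of A in the minor
-- corrected as follows:
--   A in M      vs  A in M ∖ ℓ:  cr + [ℓ coloop],  nl,  ι,  ε + [ℓ loop]
--   A ∪ ℓ in M  vs  A in M / ℓ:  cr,  nl + [ℓ loop],  ι + [ℓ coloop],  ε
-- ℓ being largest, it is never the smallest element of a circuit through another element,
-- which is why the activities of the other elements are unaffected.

module Minors {n : ℕ} (M : Matroid (suc n)) where
  open Matroid M
  open RankFacts M

  ℓ : Fin (suc n)
  ℓ = fromℕ n

  rℓ : ℕ
  rℓ = r (⊥ ∷ʳ true)

  rℓ≤ : ∀ S → rℓ ≤ r (S ∷ʳ true)
  rℓ≤ S = r-mono (∷ʳ-⊆ (⊆-min S) id)

  rℓ≤1 : rℓ ≤ 1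
  rℓ≤1 = ≤-trans (r-bound (⊥ ∷ʳ true)) (≤-reflexive (trans (∣∷ʳtrue∣ (⊥ {n})) (cong suc (∣⊥∣≡0 n))))

  rank-with-ℓ : ∀ S → r (S ∷ʳ true) ≤ r (S ∷ʳ false) + rℓ
  rank-with-ℓ S = subst (λ U → r U ≤ r (S ∷ʳ false) + rℓ)
    (trans (∪-∷ʳ S ⊥ false true) (cong (_∷ʳ true) (∪-identityʳ S))) (rank-∪ (S ∷ʳ false) (⊥ ∷ʳ true))

  rank-without-ℓ≤ : ∀ S → r (S ∷ʳ false) ≤ r (S ∷ʳ true)
  rank-without-ℓ≤ S = r-mono (∷ʳ-⊆ ⊆-refl (λ ()))

  del : Matroid n
  del = record
    { r = λ S → r (S ∷ʳ false)
    ; r-bound = λ S → ≤-trans (r-bound (S ∷ʳ false)) (≤-reflexive (∣∷ʳfalse∣ S))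
    ; r-mono = λ S⊆T → r-mono (∷ʳ-⊆ S⊆T id)
    ; r-submod = λ S T → subst₂ (λ U V → r U + r V ≤ r (S ∷ʳ false) + r (T ∷ʳ false))
        (∪-∷ʳ S T false false) (∩-∷ʳ S T false false) (r-submod (S ∷ʳ false) (T ∷ʳ false))
    }

  con : Matroid n
  con = record
    { r = λ S → r (S ∷ʳ true) ∸ rℓ
    ; r-bound = λ S → ≤-trans (∸-monoˡ-≤ rℓ (≤-trans (rank-with-ℓ S) (+-monoˡ-≤ rℓ (Matroid.r-bound del S))))
                              (≤-reflexive (m+n∸n≡m ∣ S ∣ rℓ))
    ; r-mono = λ S⊆T → ∸-monoˡ-≤ rℓ (r-mono (∷ʳ-⊆ S⊆T id))
    ; r-submod = λ S T → subst₂ _≤_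
        (sym (∸-+-distrib rℓ _ _ (rℓ≤ (S ∪ T)) (rℓ≤ (S ∩ T))))
        (sym (∸-+-distrib rℓ _ _ (rℓ≤ S) (rℓ≤ T)))
        (∸-monoˡ-≤ (rℓ + rℓ) (subst₂ (λ U V → r U + r V ≤ r (S ∷ʳ true) + r (T ∷ʳ true))
          (∪-∷ʳ S T true true) (∩-∷ʳ S T true true) (r-submod (S ∷ʳ true) (T ∷ʳ true))))
    }

  Loop Coloop : Set
  Loop = rℓ ≡ 0
  Coloop = suc (r (⊤ ∷ʳ false)) ≡ r (⊤ ∷ʳ true)

  loop? : Dec Loop
  loop? = rℓ ℕ.≟ 0

  coloop? : Dec Coloop
  coloop? = suc (r (⊤ ∷ʳ false)) ℕ.≟ r (⊤ ∷ʳ true)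

  loop⇒¬coloop : Loop → ¬ Coloop
  loop⇒¬coloop loop coloop = 1+n≰n (begin
    suc (r (⊤ ∷ʳ false))   ≡⟨ coloop ⟩
    r (⊤ ∷ʳ true)          ≤⟨ rank-with-ℓ ⊤ ⟩
    r (⊤ ∷ʳ false) + rℓ    ≡⟨ cong (λ m → r (⊤ ∷ʳ false) + m) loop ⟩
    r (⊤ ∷ʳ false) + 0     ≡⟨ +-identityʳ _ ⟩
    r (⊤ ∷ʳ false)         ∎)
    where open ≤-Reasoning

  ¬loop⇒rℓ≡1 : ¬ Loop → rℓ ≡ 1
  ¬loop⇒rℓ≡1 ¬loop = ≤-antisym rℓ≤1 (n≢0⇒n>0 ¬loop)

  ¬coloop⇒rank-equal : ¬ Coloop → r (⊤ ∷ʳ true) ≡ r (⊤ ∷ʳ false)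
  ¬coloop⇒rank-equal ¬coloop = ≤-antisym (≤-pred (≤∧≢⇒< ≤suc (¬coloop ∘ sym))) (rank-without-ℓ≤ ⊤)
    where
    ≤suc : r (⊤ ∷ʳ true) ≤ suc (r (⊤ ∷ʳ false))
    ≤suc = ≤-trans (rank-with-ℓ ⊤) (≤-trans (+-monoʳ-≤ _ rℓ≤1) (≤-reflexive (+-comm _ 1)))

  loop⇒del≡con : Loop → ∀ S → Matroid.r del S ≡ Matroid.r con S
  loop⇒del≡con loop S rewrite loop = ≤-antisym (rank-without-ℓ≤ S)
    (≤-trans (rank-with-ℓ S) (≤-reflexive (trans (cong (λ m → r (S ∷ʳ false) + m) loop) (+-identityʳ _))))

  coloop⇒del≡con : Coloop → ∀ S → Matroid.r del S ≡ Matroid.r con S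
  coloop⇒del≡con coloop S = begin
    r (S ∷ʳ false)             ≡⟨ cong (_∸ 1) (sym with-ℓ≡) ⟩
    r (S ∷ʳ true) ∸ 1          ≡⟨ cong (r (S ∷ʳ true) ∸_) (sym rℓ≡1) ⟩
    r (S ∷ʳ true) ∸ rℓ         ∎
    where
    open ≡-Reasoning
    rℓ≡1 : rℓ ≡ 1
    rℓ≡1 = ¬loop⇒rℓ≡1 (λ loop → loop⇒¬coloop loop coloop)
    submod : r (⊤ ∷ʳ true) + r (S ∷ʳ false) ≤ r (⊤ ∷ʳ false) + r (S ∷ʳ true)
    submod = subst₂ (λ U V → r U + r V ≤ r (⊤ ∷ʳ false) + r (S ∷ʳ true))
      (trans (∪-∷ʳ ⊤ S false true) (cong (_∷ʳ true) (∪-zeroˡ S)))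
      (trans (∩-∷ʳ ⊤ S false true) (cong (_∷ʳ false) (∩-identityˡ S)))
      (r-submod (⊤ ∷ʳ false) (S ∷ʳ true))
    with-ℓ≡ : r (S ∷ʳ true) ≡ suc (r (S ∷ʳ false))
    with-ℓ≡ = ≤-antisym
      (≤-trans (rank-with-ℓ S) (≤-reflexive (trans (cong (λ m → r (S ∷ʳ false) + m) rℓ≡1) (+-comm _ 1))))
      (+-cancelˡ-≤ (r (⊤ ∷ʳ false)) _ _
        (subst (_≤ r (⊤ ∷ʳ false) + r (S ∷ʳ true))
               (trans (cong (_+ r (S ∷ʳ false)) (sym coloop)) (sym (+-suc _ _))) submod))

  rk≡ : rk M ≡ r (⊤ ∷ʳ true)
  rk≡ = cong r (⊤-∷ʳ n)

  -- corank and nullity: a coloop ℓ contributes to r(E) but not to r(A)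
  cr-del : ∀ A → cr M (A ∷ʳ false) ≡ cr del A + indicator coloop?
  cr-del A with coloop?
  ... | yes coloop = begin
    rk M ∸ r (A ∷ʳ false)                    ≡⟨ cong (_∸ r (A ∷ʳ false)) (trans rk≡ (sym coloop)) ⟩
    suc (r (⊤ ∷ʳ false)) ∸ r (A ∷ʳ false)    ≡⟨ +-∸-assoc 1 (r-mono (∷ʳ-⊆ (⊆-max A) id)) ⟩
    suc (r (⊤ ∷ʳ false) ∸ r (A ∷ʳ false))    ≡⟨ +-comm 1 _ ⟩
    cr del A + 1                             ∎
    where open ≡-Reasoning
  ... | no ¬coloop = trans (cong (_∸ r (A ∷ʳ false)) (trans rk≡ (¬coloop⇒rank-equal ¬coloop)))
                           (sym (+-identityʳ _))

  nl-del : ∀ A → nl M (A ∷ʳ false) ≡ nl del A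
  nl-del A = cong (_∸ r (A ∷ʳ false)) (∣∷ʳfalse∣ A)

  -- r(A ∪ ℓ) = r_{M/ℓ}(A) + r{ℓ}, and a loop ℓ adds to |A ∪ ℓ| but not to its rank
  cr-con : ∀ A → cr M (A ∷ʳ true) ≡ cr con A
  cr-con A = trans (cong (_∸ r (A ∷ʳ true)) rk≡)
                   (sym (∸-∸-cancel rℓ _ _ (rℓ≤ A) (r-mono (∷ʳ-⊆ (⊆-max A) id))))
    where
    ∸-∸-cancel : ∀ k x y → k ≤ y → y ≤ x → (x ∸ k) ∸ (y ∸ k) ≡ x ∸ y
    ∸-∸-cancel zero x y _ _ = refl
    ∸-∸-cancel (suc k) (suc x) (suc y) (s≤s k≤y) (s≤s y≤x) = ∸-∸-cancel k x y k≤y y≤x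

  nl-con : ∀ A → nl M (A ∷ʳ true) ≡ nl con A + indicator loop?
  nl-con A with loop?
  ... | yes loop rewrite loop = begin
    ∣ A ∷ʳ true ∣ ∸ r (A ∷ʳ true)    ≡⟨ cong (_∸ r (A ∷ʳ true)) (∣∷ʳtrue∣ A) ⟩
    suc ∣ A ∣ ∸ r (A ∷ʳ true)        ≡⟨ +-∸-assoc 1 r≤∣A∣ ⟩
    suc (∣ A ∣ ∸ r (A ∷ʳ true))      ≡⟨ +-comm 1 _ ⟩
    ∣ A ∣ ∸ r (A ∷ʳ true) + 1        ∎
    where
    open ≡-Reasoning
    r≤∣A∣ : r (A ∷ʳ true) ≤ ∣ A ∣
    r≤∣A∣ = ≤-trans (rank-with-ℓ A)
              (≤-trans (≤-reflexive (trans (cong (λ m → r (A ∷ʳ false) + m) loop) (+-identityʳ _)))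
                       (Matroid.r-bound del A))
  ... | no ¬loop = begin
    ∣ A ∷ʳ true ∣ ∸ r (A ∷ʳ true)        ≡⟨ cong (_∸ r (A ∷ʳ true)) (∣∷ʳtrue∣ A) ⟩
    suc ∣ A ∣ ∸ r (A ∷ʳ true)            ≡⟨ suc-∸ (r (A ∷ʳ true)) (subst (_≤ r (A ∷ʳ true)) rℓ≡1 (rℓ≤ A)) ⟩
    ∣ A ∣ ∸ (r (A ∷ʳ true) ∸ 1)          ≡⟨ cong (λ k → ∣ A ∣ ∸ (r (A ∷ʳ true) ∸ k)) (sym rℓ≡1) ⟩
    nl con A                             ≡⟨ sym (+-identityʳ _) ⟩
    nl con A + 0                         ∎
    where
    open ≡-Reasoning
    rℓ≡1 : rℓ ≡ 1
    rℓ≡1 = ¬loop⇒rℓ≡1 ¬loop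
    suc-∸ : ∀ x → 1 ≤ x → suc ∣ A ∣ ∸ x ≡ ∣ A ∣ ∸ (x ∸ 1)
    suc-∸ (suc x) _ = refl

  private
    module RM = ActivityByRank M
    module RD = ActivityByRank del
    module RC = ActivityByRank con
    module CM = ActivityCount M
    module CD = ActivityCount del
    module CC = ActivityCount con

  -- ℓ ∉ A is externally active exactly when it is a loop; the other activities are unchanged
  ε-del : ∀ A → ε M (A ∷ʳ false) ≡ ε del A + indicator loop?
  ε-del A = begin
    ε M (A ∷ʳ false)
      ≡⟨ CM.ε≡ (A ∷ʳ false) ⟩
    count (RM.extActiveR? (A ∷ʳ false))
      ≡⟨ count-last-cong (RM.extActiveR? (A ∷ʳ false)) (RD.extActiveR? A) loop? below⇒ ⇒below last⇒ ⇒last ⟩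
    count (RD.extActiveR? A) + indicator loop?
      ≡⟨ cong (_+ indicator loop?) (sym (CD.ε≡ A)) ⟩
    ε del A + indicator loop? ∎
    where
    open ≡-Reasoning
    below⇒ : ∀ f → RM.ExtActiveR (A ∷ʳ false) (inject₁ f) → RD.ExtActiveR A f
    below⇒ f (f∉ , eq) = f∉ ∘ inject₁-∈⁺ f ,
      trans (cong r (sym (ext-set-∷ʳ A f false))) (trans eq (cong r (above-inject₁ f A false)))
    ⇒below : ∀ f → RD.ExtActiveR A f → RM.ExtActiveR (A ∷ʳ false) (inject₁ f)
    ⇒below f (f∉ , eq) = f∉ ∘ inject₁-∈⁻ f ,
      trans (cong r (ext-set-∷ʳ A f false)) (trans eq (cong r (sym (above-inject₁ f A false))))
    above-ℓ : r (above ℓ (A ∷ʳ false)) ≡ 0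
    above-ℓ = trans (cong r (above-fromℕ n (A ∷ʳ false))) rank-∅
    ext-set-ℓ : above ℓ (A ∷ʳ false) ∪ ⁅ ℓ ⁆ ≡ ⊥ ∷ʳ true
    ext-set-ℓ rewrite above-fromℕ n (A ∷ʳ false) = trans (∪-identityˡ ⁅ ℓ ⁆) (⁅fromℕ⁆ n)
    last⇒ : RM.ExtActiveR (A ∷ʳ false) ℓ → Loop
    last⇒ (_ , eq) = trans (cong r (sym ext-set-ℓ)) (trans eq above-ℓ)
    ⇒last : Loop → RM.ExtActiveR (A ∷ʳ false) ℓ
    ⇒last loop = fromℕ-∉ A , trans (cong r ext-set-ℓ) (trans loop (sym above-ℓ))

  -- ℓ ∈ A ∪ ℓ is never externally active
  ε-con : ∀ A → ε M (A ∷ʳ true) ≡ ε con A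
  ε-con A = trans (CM.ε≡ (A ∷ʳ true))
    (trans (count-last-cong₀ (RM.extActiveR? (A ∷ʳ true)) (RC.extActiveR? A)
                              below⇒ ⇒below (λ (ℓ∉ , _) → ℓ∉ (fromℕ-∈⁺ A)))
           (sym (CC.ε≡ A)))
    where
    below⇒ : ∀ f → RM.ExtActiveR (A ∷ʳ true) (inject₁ f) → RC.ExtActiveR A f
    below⇒ f (f∉ , eq) = f∉ ∘ inject₁-∈⁺ f ,
      cong (_∸ rℓ) (trans (cong r (sym (ext-set-∷ʳ A f true))) (trans eq (cong r (above-inject₁ f A true))))
    ⇒below : ∀ f → RC.ExtActiveR A f → RM.ExtActiveR (A ∷ʳ true) (inject₁ f)
    ⇒below f (f∉ , eq) = f∉ ∘ inject₁-∈⁻ f ,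
      trans (cong r (ext-set-∷ʳ A f true))
            (trans (∸-cancelʳ-≡ (rℓ≤ _) (rℓ≤ _) eq) (cong r (sym (above-inject₁ f A true))))

  -- ℓ ∉ A is never internally active
  ι-del : ∀ A → ι M (A ∷ʳ false) ≡ ι del A
  ι-del A = trans (CM.ι≡ (A ∷ʳ false))
    (trans (count-last-cong₀ (RM.intActiveR? (A ∷ʳ false)) (RD.intActiveR? A)
                              below⇒ ⇒below (λ (ℓ∈ , _) → fromℕ-∉ A ℓ∈))
           (sym (CD.ι≡ A)))
    where
    below⇒ : ∀ f → RM.IntActiveR (A ∷ʳ false) (inject₁ f) → RD.IntActiveR A f
    below⇒ f (f∈ , eq) = inject₁-∈⁻ f f∈ ,
      trans (cong (suc ∘ r) (sym (int-set′-∷ʳ A f false))) (trans eq (cong r (int-set-∷ʳ A f false)))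
    ⇒below : ∀ f → RD.IntActiveR A f → RM.IntActiveR (A ∷ʳ false) (inject₁ f)
    ⇒below f (f∈ , eq) = inject₁-∈⁺ f f∈ ,
      trans (cong (suc ∘ r) (int-set′-∷ʳ A f false)) (trans eq (cong r (sym (int-set-∷ʳ A f false))))

  -- ℓ ∈ A ∪ ℓ is internally active exactly when it is a coloop; the others are unchanged
  ι-con : ∀ A → ι M (A ∷ʳ true) ≡ ι con A + indicator coloop?
  ι-con A = begin
    ι M (A ∷ʳ true)
      ≡⟨ CM.ι≡ (A ∷ʳ true) ⟩
    count (RM.intActiveR? (A ∷ʳ true))
      ≡⟨ count-last-cong (RM.intActiveR? (A ∷ʳ true)) (RC.intActiveR? A) coloop? below⇒ ⇒below last⇒ ⇒last ⟩
    count (RC.intActiveR? A) + indicator coloop?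
      ≡⟨ cong (_+ indicator coloop?) (sym (CC.ι≡ A)) ⟩
    ι con A + indicator coloop? ∎
    where
    open ≡-Reasoning
    below⇒ : ∀ f → RM.IntActiveR (A ∷ʳ true) (inject₁ f) → RC.IntActiveR A f
    below⇒ f (f∈ , eq) = inject₁-∈⁻ f f∈ ,
      trans (sym (+-∸-assoc 1 (rℓ≤ _)))
            (cong (_∸ rℓ) (trans (cong (suc ∘ r) (sym (int-set′-∷ʳ A f true))) (trans eq (cong r (int-set-∷ʳ A f true)))))
    ⇒below : ∀ f → RC.IntActiveR A f → RM.IntActiveR (A ∷ʳ true) (inject₁ f)
    ⇒below f (f∈ , eq) = inject₁-∈⁺ f f∈ ,
      trans (cong (suc ∘ r) (int-set′-∷ʳ A f true))
            (trans (∸-cancelʳ-≡ (≤-trans (rℓ≤ _) (n≤1+n _)) (rℓ≤ _) (trans (+-∸-assoc 1 (rℓ≤ _)) eq))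
                   (cong r (sym (int-set-∷ʳ A f true))))
    int-set-ℓ : ∀ S → ∁ (above ℓ (∁ S)) ≡ ⊤ ∷ʳ true
    int-set-ℓ S rewrite above-fromℕ n (∁ S) | ∁⊥≡⊤ (suc n) = ⊤-∷ʳ n
    int-set′-ℓ : ∀ S → ∁ (above ℓ (∁ S) ∪ ⁅ ℓ ⁆) ≡ ⊤ ∷ʳ false
    int-set′-ℓ S rewrite above-fromℕ n (∁ S) | ∪-identityˡ ⁅ ℓ ⁆ | ⁅fromℕ⁆ n
                       | map-∷ʳ not true (⊥ {n}) | ∁⊥≡⊤ n = refl
    last⇒ : RM.IntActiveR (A ∷ʳ true) ℓ → Coloop
    last⇒ (_ , eq) = trans (cong (suc ∘ r) (sym (int-set′-ℓ (A ∷ʳ true)))) (trans eq (cong r (int-set-ℓ (A ∷ʳ true))))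
    ⇒last : Coloop → RM.IntActiveR (A ∷ʳ true) ℓ
    ⇒last coloop = fromℕ-∈⁺ A ,
      trans (cong (suc ∘ r) (int-set′-ℓ (A ∷ʳ true))) (trans coloop (cong r (sym (int-set-ℓ (A ∷ʳ true)))))

module SubsetSum {V : Set} (_⊕_ : V → V → V)
  (⊕-assoc : ∀ a b c → (a ⊕ b) ⊕ c ≡ a ⊕ (b ⊕ c))
  (⊕-comm : ∀ a b → a ⊕ b ≡ b ⊕ a) where

  sumS : ∀ n → (Subset n → V) → V
  sumS zero f = f []
  sumS (suc n) f = sumS n (f ∘ (true ∷_)) ⊕ sumS n (f ∘ (false ∷_))

  sumS-cong : ∀ n {f g : Subset n → V} → (∀ A → f A ≡ g A) → sumS n f ≡ sumS n g
  sumS-cong zero f≗g = f≗g []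
  sumS-cong (suc n) f≗g = cong₂ _⊕_ (sumS-cong n (f≗g ∘ (true ∷_))) (sumS-cong n (f≗g ∘ (false ∷_)))

  ⊕-interchange : ∀ a b c d → (a ⊕ b) ⊕ (c ⊕ d) ≡ (a ⊕ c) ⊕ (b ⊕ d)
  ⊕-interchange a b c d = begin
    (a ⊕ b) ⊕ (c ⊕ d)   ≡⟨ ⊕-assoc a b (c ⊕ d) ⟩
    a ⊕ (b ⊕ (c ⊕ d))   ≡⟨ cong (a ⊕_) (sym (⊕-assoc b c d)) ⟩
    a ⊕ ((b ⊕ c) ⊕ d)   ≡⟨ cong (λ x → a ⊕ (x ⊕ d)) (⊕-comm b c) ⟩
    a ⊕ ((c ⊕ b) ⊕ d)   ≡⟨ cong (a ⊕_) (⊕-assoc c b d) ⟩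
    a ⊕ (c ⊕ (b ⊕ d))   ≡⟨ sym (⊕-assoc a c (b ⊕ d)) ⟩
    (a ⊕ c) ⊕ (b ⊕ d)   ∎
    where open ≡-Reasoning

  sumS-⊕ : ∀ n (f g : Subset n → V) → sumS n (λ A → f A ⊕ g A) ≡ sumS n f ⊕ sumS n g
  sumS-⊕ zero f g = refl
  sumS-⊕ (suc n) f g = trans (cong₂ _⊕_ (sumS-⊕ n _ _) (sumS-⊕ n _ _)) (⊕-interchange _ _ _ _)

  sumS-∷ʳ : ∀ n (f : Subset (suc n) → V) → sumS (suc n) f ≡ sumS n (λ A → f (A ∷ʳ true) ⊕ f (A ∷ʳ false))
  sumS-∷ʳ zero f = refl
  sumS-∷ʳ (suc n) f = cong₂ _⊕_ (sumS-∷ʳ n (f ∘ (true ∷_))) (sumS-∷ʳ n (f ∘ (false ∷_)))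

  Weight : Set
  Weight = ℕ → ℕ → ℕ → ℕ → V

  infix 30 Σ[_]_
  Σ[_]_ : ∀ {n} → Matroid n → Weight → V
  Σ[_]_ {n} M w = sumS n (λ A → w (cr M A) (nl M A) (ι M A) (ε M A))

  sumS-const : ∀ {x} → x ⊕ x ≡ x → ∀ n → sumS n (λ _ → x) ≡ x
  sumS-const x⊕x≡x zero = refl
  sumS-const x⊕x≡x (suc n) = trans (cong₂ _⊕_ (sumS-const x⊕x≡x n) (sumS-const x⊕x≡x n)) x⊕x≡x

  Σ-same-rank : ∀ {n} (M₁ M₂ : Matroid n) → (∀ S → Matroid.r M₁ S ≡ Matroid.r M₂ S) →
                ∀ w → Σ[ M₁ ] w ≡ Σ[ M₂ ] w
  Σ-same-rank {n} M₁ M₂ r≡ w = sumS-cong n λ A → w-cong (same-rank⇒same-statistics M₁ M₂ r≡ A)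
    where
    w-cong : ∀ {c c′ l l′ i i′ e e′} → c ≡ c′ × l ≡ l′ × i ≡ i′ × e ≡ e′ → w c l i e ≡ w c′ l′ i′ e′
    w-cong (refl , refl , refl , refl) = refl

  Σ-cong : ∀ {n} (M : Matroid n) {f g : Weight} → (∀ c l i e → f c l i e ≡ g c l i e) → Σ[ M ] f ≡ Σ[ M ] g
  Σ-cong {n} M f≗g = sumS-cong n (λ A → f≗g _ _ _ _)

  Σ-⊕ : ∀ {n} (M : Matroid n) (f g : Weight) → Σ[ M ] (λ c l i e → f c l i e ⊕ g c l i e) ≡ Σ[ M ] f ⊕ Σ[ M ] g
  Σ-⊕ {n} M f g = sumS-⊕ n _ _

  Σ-const : ∀ {n} (M : Matroid n) {x} → x ⊕ x ≡ x → ∀ w → (∀ c l i e → w c l i e ≡ x) → Σ[ M ] w ≡ x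
  Σ-const {n} M x⊕x≡x w w≡x = trans (sumS-cong n (λ A → w≡x _ _ _ _)) (sumS-const x⊕x≡x n)

-- x + [P] computed by cases, so that it reduces to suc x or x
_+?_ : ∀ {P : Set} → ℕ → Dec P → ℕ
x +? yes _ = suc x
x +? no _ = x

+indicator : ∀ {P : Set} x (d : Dec P) → x + indicator d ≡ x +? d
+indicator x (yes _) = +-comm x 1
+indicator x (no _) = +-identityʳ x

-- Summing a weight over M by splitting on the largest element ℓ: subsets containing ℓ
-- correspond to subsets of the contraction, the others to subsets of the deletion.

module DeletionContraction {V : Set} (_⊕_ : V → V → V)
  (⊕-assoc : ∀ a b c → (a ⊕ b) ⊕ c ≡ a ⊕ (b ⊕ c))
  (⊕-comm : ∀ a b → a ⊕ b ≡ b ⊕ a) {n : ℕ} (M : Matroid (suc n)) where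
  open SubsetSum _⊕_ ⊕-assoc ⊕-comm
  open Minors M

  -- ℓ ∈ A: statistics of A ∖ ℓ in M / ℓ; ℓ ∉ A: statistics of A in M ∖ ℓ (Minors)
  Σ-split : ∀ w → Σ[ M ] w ≡ Σ[ con ] (λ c l i e → w c (l +? loop?) (i +? coloop?) e)
                           ⊕ Σ[ del ] (λ c l i e → w (c +? coloop?) l i (e +? loop?))
  Σ-split w = begin
    Σ[ M ] w
      ≡⟨ sumS-∷ʳ n weight ⟩
    sumS n (λ A → weight (A ∷ʳ true) ⊕ weight (A ∷ʳ false))
      ≡⟨ sumS-⊕ n _ _ ⟩
    sumS n (weight ∘ (_∷ʳ true)) ⊕ sumS n (weight ∘ (_∷ʳ false))
      ≡⟨ cong₂ _⊕_ (sumS-cong n with-ℓ) (sumS-cong n without-ℓ) ⟩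
    sumS n weight-con ⊕ sumS n weight-del ∎
    where
    open ≡-Reasoning
    weight : Subset (suc n) → V
    weight A = w (cr M A) (nl M A) (ι M A) (ε M A)
    weight-con weight-del : Subset n → V
    weight-con A = w (cr con A) (nl con A +? loop?) (ι con A +? coloop?) (ε con A)
    weight-del A = w (cr del A +? coloop?) (nl del A) (ι del A) (ε del A +? loop?)
    w-cong : ∀ {c c′ l l′ i i′ e e′} → c ≡ c′ → l ≡ l′ → i ≡ i′ → e ≡ e′ → w c l i e ≡ w c′ l′ i′ e′
    w-cong refl refl refl refl = refl
    with-ℓ : ∀ A → weight (A ∷ʳ true) ≡ weight-con A
    with-ℓ A = w-cong (cr-con A) (trans (nl-con A) (+indicator _ loop?)) (trans (ι-con A) (+indicator _ coloop?)) (ε-con A)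
    without-ℓ : ∀ A → weight (A ∷ʳ false) ≡ weight-del A
    without-ℓ A = w-cong (trans (cr-del A) (+indicator _ coloop?)) (nl-del A) (ι-del A) (trans (ε-del A) (+indicator _ loop?))

  Σ-generic : ¬ Loop → ¬ Coloop → ∀ w → Σ[ M ] w ≡ Σ[ con ] w ⊕ Σ[ del ] w
  Σ-generic ¬loop ¬coloop w = trans (Σ-split w) unchanged
    where
    unchanged : Σ[ con ] (λ c l i e → w c (l +? loop?) (i +? coloop?) e) ⊕ Σ[ del ] (λ c l i e → w (c +? coloop?) l i (e +? loop?))
              ≡ Σ[ con ] w ⊕ Σ[ del ] w
    unchanged with loop? | coloop?
    ... | yes loop | _ = contradiction loop ¬loop
    ... | no _ | yes coloop = contradiction coloop ¬coloop
    ... | no _ | no _ = refl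

  Σ-loop : Loop → ∀ w → Σ[ M ] w ≡ Σ[ del ] (λ c l i e → w c (suc l) i e) ⊕ Σ[ del ] (λ c l i e → w c l i (suc e))
  Σ-loop loop w = trans (Σ-split w) (trans shifted (cong (_⊕ Σ[ del ] (λ c l i e → w c l i (suc e))) con≡del))
    where
    con≡del : Σ[ con ] (λ c l i e → w c (suc l) i e) ≡ Σ[ del ] (λ c l i e → w c (suc l) i e)
    con≡del = sym (Σ-same-rank del con (loop⇒del≡con loop) (λ c l i e → w c (suc l) i e))
    shifted : Σ[ con ] (λ c l i e → w c (l +? loop?) (i +? coloop?) e) ⊕ Σ[ del ] (λ c l i e → w (c +? coloop?) l i (e +? loop?))
            ≡ Σ[ con ] (λ c l i e → w c (suc l) i e) ⊕ Σ[ del ] (λ c l i e → w c l i (suc e))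
    shifted with loop? | coloop?
    ... | no ¬loop | _ = contradiction loop ¬loop
    ... | yes _ | yes coloop = contradiction coloop (loop⇒¬coloop loop)
    ... | yes _ | no _ = refl

  Σ-coloop : Coloop → ∀ w → Σ[ M ] w ≡ Σ[ del ] (λ c l i e → w c l (suc i) e) ⊕ Σ[ del ] (λ c l i e → w (suc c) l i e)
  Σ-coloop coloop w = trans (Σ-split w) (trans shifted (cong (_⊕ Σ[ del ] (λ c l i e → w (suc c) l i e)) con≡del))
    where
    con≡del : Σ[ con ] (λ c l i e → w c l (suc i) e) ≡ Σ[ del ] (λ c l i e → w c l (suc i) e)
    con≡del = sym (Σ-same-rank del con (coloop⇒del≡con coloop) (λ c l i e → w c l (suc i) e))
    shifted : Σ[ con ] (λ c l i e → w c (l +? loop?) (i +? coloop?) e) ⊕ Σ[ del ] (λ c l i e → w (c +? coloop?) l i (e +? loop?))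
            ≡ Σ[ con ] (λ c l i e → w c l (suc i) e) ⊕ Σ[ del ] (λ c l i e → w (suc c) l i e)
    shifted with loop? | coloop?
    ... | yes loop | _ = contradiction coloop (loop⇒¬coloop loop)
    ... | no _ | no ¬coloop = contradiction coloop ¬coloop
    ... | no _ | yes _ = refl

module ℕSum = SubsetSum _+_ +-assoc +-comm

kron : ℕ → ℕ → ℕ
kron zero zero = 1
kron zero (suc _) = 0
kron (suc _) zero = 0
kron (suc a) (suc b) = kron a b

point : ℕ → ℕ → ℕ → ℕ → ℕSum.Weight
point c l i e c′ l′ i′ e′ = kron c′ c * (kron l′ l * (kron i′ i * kron e′ e))

N : ∀ {n} → Matroid n → ℕ → ℕ → ℕ → ℕ → ℕ
N M c l i e = ℕSum.Σ[ M ] point c l i e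

-- T M k m counts the bases with internal activity k and external activity m
T : ∀ {n} → Matroid n → ℕ → ℕ → ℕ
T M k m = N M 0 0 k m

-- bin a b = (a + b)! / (a! b!), by Pascal's rule
bin : ℕ → ℕ → ℕ
bin zero b = 1
bin (suc a) zero = 1
bin (suc a) (suc b) = bin a (suc b) + bin (suc a) b

bin-a0 : ∀ a → bin a 0 ≡ 1
bin-a0 zero = refl
bin-a0 (suc a) = refl

zero-product₂ : ∀ x y → x * (y * 0) ≡ 0
zero-product₂ x y rewrite *-zeroʳ y = *-zeroʳ x

zero-product₃ : ∀ x y z → x * (y * (z * 0)) ≡ 0
zero-product₃ x y z rewrite *-zeroʳ z = zero-product₂ x y

Σ-zero : ∀ {n} (M : Matroid n) w → (∀ c l i e → w c l i e ≡ 0) → ℕSum.Σ[ M ] w ≡ 0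
Σ-zero M = ℕSum.Σ-const M refl

module TutteCounts {n : ℕ} (M : Matroid (suc n)) where
  open Minors M
  open DeletionContraction _+_ +-assoc +-comm M

  -- a loop is externally active in every basis
  T-loop-zero : Loop → ∀ k → T M k 0 ≡ 0
  T-loop-zero loop k = trans (Σ-loop loop (point 0 0 k 0))
    (cong₂ _+_ (Σ-zero del _ (λ c _ _ _ → *-zeroʳ (kron c 0)))
               (Σ-zero del _ (λ c l i _ → zero-product₃ (kron c 0) (kron l 0) (kron i k))))

  T-loop-suc : Loop → ∀ k m → T M k (suc m) ≡ T del k m
  T-loop-suc loop k m = trans (Σ-loop loop (point 0 0 k (suc m)))
    (cong (_+ T del k m) (Σ-zero del _ (λ c _ _ _ → *-zeroʳ (kron c 0))))

  -- a coloop is internally active in every basis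
  T-coloop-zero : Coloop → ∀ m → T M 0 m ≡ 0
  T-coloop-zero coloop m = trans (Σ-coloop coloop (point 0 0 0 m))
    (cong₂ _+_ (Σ-zero del _ (λ c l _ _ → zero-product₂ (kron c 0) (kron l 0)))
               (Σ-zero del _ (λ _ _ _ _ → refl)))

  T-coloop-suc : Coloop → ∀ k m → T M (suc k) m ≡ T del k m
  T-coloop-suc coloop k m = trans (Σ-coloop coloop (point 0 0 (suc k) m))
    (trans (cong (λ t → T del k m + t) (Σ-zero del _ (λ _ _ _ _ → refl))) (+-identityʳ _))

  T-generic : ¬ Loop → ¬ Coloop → ∀ k m → T M k m ≡ T con k m + T del k m
  T-generic ¬loop ¬coloop k m = Σ-generic ¬loop ¬coloop (point 0 0 k m)

-- The refined count: a subset with statistics (c, l, i, e) is determined by a basis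
-- with activities (c + i, l + e) together with a choice of i of its c + i internally
-- active elements and e of its l + e externally active elements.
CountFormula : ∀ {n} → Matroid n → Set
CountFormula M = ∀ c l i e → N M c l i e ≡ bin c i * bin l e * T M (c + i) (l + e)

distrib-middle : ∀ b x y t → b * (x + y) * t ≡ b * x * t + b * y * t
distrib-middle = solve-∀

distrib-left : ∀ x y b t → (x + y) * b * t ≡ y * b * t + x * b * t
distrib-left = solve-∀

count-formula-empty : (M : Matroid 0) → CountFormula M
count-formula-empty M c l i e rewrite n∸n≡0 (Matroid.r M []) | 0∸n≡0 (Matroid.r M []) = at-origin c l i e
  where
  at-origin : ∀ c l i e → point c l i e 0 0 0 0 ≡ bin c i * bin l e * point 0 0 (c + i) (l + e) 0 0 0 0
  at-origin (suc c) l i e = sym (*-zeroʳ (bin (suc c) i * bin l e))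
  at-origin zero l (suc i) e = trans (cong (_+ 0) (*-zeroʳ (kron 0 l))) (sym (*-zeroʳ (bin 0 (suc i) * bin l e)))
  at-origin zero (suc l) zero e = sym (*-zeroʳ (bin 0 0 * bin (suc l) e))
  at-origin zero zero zero (suc e) = sym (*-zeroʳ (bin 0 0 * bin 0 (suc e)))
  at-origin zero zero zero zero = refl

module CountFormulaSteps {n : ℕ} (M : Matroid (suc n)) where
  open Minors M
  open DeletionContraction _+_ +-assoc +-comm M
  open TutteCounts M

  -- ℓ a loop: Pascal's rule  bin l e = bin (l - 1) e + bin l (e - 1)  in the nullity/external-activity pair
  count-formula-loop : Loop → CountFormula del → CountFormula M
  count-formula-loop loop IH c l i e = trans (Σ-loop loop (point c l i e)) (split l e)
    where
    -- a shifted coordinate cannot match the target value 0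
    no-l : ℕSum.Σ[ del ] (λ c′ l′ i′ e′ → point c 0 i e c′ (suc l′) i′ e′) ≡ 0
    no-l = Σ-zero del _ (λ c′ _ _ _ → *-zeroʳ (kron c′ c))
    no-e : ∀ l → ℕSum.Σ[ del ] (λ c′ l′ i′ e′ → point c l i 0 c′ l′ i′ (suc e′)) ≡ 0
    no-e l = Σ-zero del _ (λ c′ l′ i′ _ → zero-product₃ (kron c′ c) (kron l′ l) (kron i′ i))
    split : ∀ l e → ℕSum.Σ[ del ] (λ c′ l′ i′ e′ → point c l i e c′ (suc l′) i′ e′)
                    + ℕSum.Σ[ del ] (λ c′ l′ i′ e′ → point c l i e c′ l′ i′ (suc e′))
                  ≡ bin c i * bin l e * T M (c + i) (l + e)
    split zero zero = begin
      _                                ≡⟨ cong₂ _+_ no-l (no-e 0) ⟩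
      0 + 0                            ≡⟨⟩
      0                                ≡⟨ sym (*-zeroʳ (bin c i * 1)) ⟩
      bin c i * 1 * 0                  ≡⟨ cong (bin c i * 1 *_) (sym (T-loop-zero loop (c + i))) ⟩
      bin c i * 1 * T M (c + i) 0      ∎
      where open ≡-Reasoning
    split (suc l) zero = begin
      _
        ≡⟨ cong₂ _+_ (IH c l i 0) (no-e (suc l)) ⟩
      bin c i * bin l 0 * T del (c + i) (l + 0) + 0
        ≡⟨ +-identityʳ _ ⟩
      bin c i * bin l 0 * T del (c + i) (l + 0)
        ≡⟨ cong₂ (λ b t → bin c i * b * t) (bin-a0 l) (sym (T-loop-suc loop (c + i) (l + 0))) ⟩
      bin c i * 1 * T M (c + i) (suc l + 0) ∎
      where open ≡-Reasoning
    split zero (suc e) = begin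
      _                                ≡⟨ cong₂ _+_ no-l (IH c 0 i e) ⟩
      bin c i * 1 * T del (c + i) e    ≡⟨ cong (bin c i * 1 *_) (sym (T-loop-suc loop (c + i) e)) ⟩
      bin c i * 1 * T M (c + i) (suc e) ∎
      where open ≡-Reasoning
    split (suc l) (suc e) = begin
      N del c l i (suc e) + N del c (suc l) i e
        ≡⟨ cong₂ _+_ (IH c l i (suc e))
                     (trans (IH c (suc l) i e) (cong (λ m → b * bin (suc l) e * T del (c + i) m) (sym (+-suc l e)))) ⟩
      b * bin l (suc e) * t + b * bin (suc l) e * t
        ≡⟨ sym (distrib-middle b (bin l (suc e)) (bin (suc l) e) t) ⟩
      b * (bin l (suc e) + bin (suc l) e) * t
        ≡⟨ cong (b * bin (suc l) (suc e) *_) (sym (T-loop-suc loop (c + i) (l + suc e))) ⟩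
      b * bin (suc l) (suc e) * T M (c + i) (suc l + suc e) ∎
      where
      open ≡-Reasoning
      b t : ℕ
      b = bin c i
      t = T del (c + i) (l + suc e)

  -- ℓ a coloop: Pascal's rule in the corank/internal-activity pair
  count-formula-coloop : Coloop → CountFormula del → CountFormula M
  count-formula-coloop coloop IH c l i e = trans (Σ-coloop coloop (point c l i e)) (split c i)
    where
    -- a shifted coordinate cannot match the target value 0
    no-i : ∀ c → ℕSum.Σ[ del ] (λ c′ l′ i′ e′ → point c l 0 e c′ l′ (suc i′) e′) ≡ 0
    no-i c = Σ-zero del _ (λ c′ l′ _ _ → zero-product₂ (kron c′ c) (kron l′ l))
    no-c : ∀ i → ℕSum.Σ[ del ] (λ c′ l′ i′ e′ → point 0 l i e (suc c′) l′ i′ e′) ≡ 0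
    no-c i = Σ-zero del _ (λ _ _ _ _ → refl)
    split : ∀ c i → ℕSum.Σ[ del ] (λ c′ l′ i′ e′ → point c l i e c′ l′ (suc i′) e′)
                    + ℕSum.Σ[ del ] (λ c′ l′ i′ e′ → point c l i e (suc c′) l′ i′ e′)
                  ≡ bin c i * bin l e * T M (c + i) (l + e)
    split zero zero = begin
      _                                ≡⟨ cong₂ _+_ (no-i 0) (no-c 0) ⟩
      0 + 0                            ≡⟨⟩
      0                                ≡⟨ sym (*-zeroʳ (1 * bin l e)) ⟩
      1 * bin l e * 0                  ≡⟨ cong (1 * bin l e *_) (sym (T-coloop-zero coloop (l + e))) ⟩
      1 * bin l e * T M 0 (l + e)      ∎
      where open ≡-Reasoning
    split (suc c) zero = begin
      _
        ≡⟨ cong₂ _+_ (no-i (suc c)) (IH c l 0 e) ⟩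
      bin c 0 * bin l e * T del (c + 0) (l + e)
        ≡⟨ cong₂ (λ b t → b * bin l e * t) (bin-a0 c) (sym (T-coloop-suc coloop (c + 0) (l + e))) ⟩
      1 * bin l e * T M (suc c + 0) (l + e) ∎
      where open ≡-Reasoning
    split zero (suc i) = begin
      _                                ≡⟨ cong₂ _+_ (IH 0 l i e) (no-c (suc i)) ⟩
      1 * bin l e * T del i (l + e) + 0  ≡⟨ +-identityʳ _ ⟩
      1 * bin l e * T del i (l + e)      ≡⟨ cong (1 * bin l e *_) (sym (T-coloop-suc coloop i (l + e))) ⟩
      1 * bin l e * T M (suc i) (l + e)  ∎
      where open ≡-Reasoning
    split (suc c) (suc i) = begin
      N del (suc c) l i e + N del c l (suc i) e
        ≡⟨ cong₂ _+_ (trans (IH (suc c) l i e) (cong (λ k → bin (suc c) i * bin l e * T del k (l + e)) (sym (+-suc c i))))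
                     (IH c l (suc i) e) ⟩
      bin (suc c) i * bin l e * t + bin c (suc i) * bin l e * t
        ≡⟨ sym (distrib-left (bin c (suc i)) (bin (suc c) i) (bin l e) t) ⟩
      bin (suc c) (suc i) * bin l e * t
        ≡⟨ cong (bin (suc c) (suc i) * bin l e *_) (sym (T-coloop-suc coloop (c + suc i) (l + e))) ⟩
      bin (suc c) (suc i) * bin l e * T M (suc c + suc i) (l + e) ∎
      where
      open ≡-Reasoning
      t : ℕ
      t = T del (c + suc i) (l + e)

  -- ℓ neither: both minors contribute with the same binomial factors
  count-formula-generic : ¬ Loop → ¬ Coloop → CountFormula con → CountFormula del → CountFormula M
  count-formula-generic ¬loop ¬coloop IH-con IH-del c l i e = begin
    N M c l i e                                   ≡⟨ Σ-generic ¬loop ¬coloop (point c l i e) ⟩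
    N con c l i e + N del c l i e                 ≡⟨ cong₂ _+_ (IH-con c l i e) (IH-del c l i e) ⟩
    b * T con k m + b * T del k m                 ≡⟨ sym (*-distribˡ-+ b _ _) ⟩
    b * (T con k m + T del k m)                   ≡⟨ cong (b *_) (sym (T-generic ¬loop ¬coloop k m)) ⟩
    b * T M k m                                   ∎
    where
    open ≡-Reasoning
    b k m : ℕ
    b = bin c i * bin l e
    k = c + i
    m = l + e

count-formula : ∀ n (M : Matroid n) → CountFormula M
count-formula zero M = count-formula-empty M
count-formula (suc n) M with Minors.loop? M | Minors.coloop? M
... | yes loop | _ = CountFormulaSteps.count-formula-loop M loop (count-formula n (Minors.del M))
... | no ¬loop | yes coloop = CountFormulaSteps.count-formula-coloop M coloop (count-formula n (Minors.del M))
... | no ¬loop | no ¬coloop =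
  CountFormulaSteps.count-formula-generic M ¬loop ¬coloop (count-formula n (Minors.con M)) (count-formula n (Minors.del M))

open import Data.Integer using (+_; -_)

-- Expanding (x-1)^cr (y-1)^nl, the
-- coefficient of x^u y^v in t(M) is  τ M u v = Σ_A β(cr A, u) β(nl A, v), where
-- β a u is the coefficient of x^u in (x - 1)^a.  Tutte's theorem identifies it with
-- T M u v, again by deletion–contraction.

β : ℕ → ℕ → ℤ
β zero zero = + 1
β zero (suc _) = + 0
β (suc a) zero = - β a zero
β (suc a) (suc u) = β a u ℤ.- β a (suc u)

module ℤSum = SubsetSum ℤ._+_ ℤP.+-assoc ℤP.+-comm

τ : ∀ {n} → Matroid n → ℕ → ℕ → ℤ
τ M u v = ℤSum.Σ[ M ] (λ c l _ _ → β c u ℤ.* β l v)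

-- (x - 1)^(a+1) = x (x - 1)^a - (x - 1)^a, read at x^0 and at x^(u+1)
β-step-zero : ∀ a → β (suc a) 0 ℤ.+ β a 0 ≡ + 0
β-step-zero a = ℤP.+-inverseˡ (β a 0)

β-step-suc : ∀ a u → β (suc a) (suc u) ℤ.+ β a (suc u) ≡ β a u
β-step-suc a u = begin
  β a u ℤ.- β a (suc u) ℤ.+ β a (suc u)     ≡⟨ ℤP.+-assoc (β a u) (- β a (suc u)) (β a (suc u)) ⟩
  β a u ℤ.+ (- β a (suc u) ℤ.+ β a (suc u)) ≡⟨ cong (λ z → β a u ℤ.+ z) (ℤP.+-inverseˡ (β a (suc u))) ⟩
  β a u ℤ.+ + 0                             ≡⟨ ℤP.+-identityʳ (β a u) ⟩
  β a u                                     ∎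
  where open ≡-Reasoning

TutteFormula : ∀ {n} → Matroid n → Set
TutteFormula M = ∀ u v → τ M u v ≡ + T M u v

tutte-formula-empty : (M : Matroid 0) → TutteFormula M
tutte-formula-empty M u v rewrite n∸n≡0 (Matroid.r M []) | 0∸n≡0 (Matroid.r M []) = at-origin u v
  where
  at-origin : ∀ u v → β 0 u ℤ.* β 0 v ≡ + point 0 0 u v 0 0 0 0
  at-origin zero zero = refl
  at-origin zero (suc v) = refl
  at-origin (suc u) v = ℤP.*-zeroˡ (β 0 v)

module TutteFormulaSteps {n : ℕ} (M : Matroid (suc n)) where
  open Minors M
  open DeletionContraction ℤ._+_ ℤP.+-assoc ℤP.+-comm M
  open TutteCounts M

  τ-loop : Loop → ∀ u v → τ M u v ≡ ℤSum.Σ[ del ] (λ c l _ _ → β c u ℤ.* (β (suc l) v ℤ.+ β l v))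
  τ-loop loop u v = trans (Σ-loop loop (λ c l _ _ → β c u ℤ.* β l v))
    (trans (sym (ℤSum.Σ-⊕ del (λ c l _ _ → β c u ℤ.* β (suc l) v) (λ c l _ _ → β c u ℤ.* β l v)))
    (ℤSum.Σ-cong del λ c l _ _ → sym (ℤP.*-distribˡ-+ (β c u) (β (suc l) v) (β l v))))

  τ-coloop : Coloop → ∀ u v → τ M u v ≡ ℤSum.Σ[ del ] (λ c l _ _ → (β (suc c) u ℤ.+ β c u) ℤ.* β l v)
  τ-coloop coloop u v = trans (Σ-coloop coloop (λ c l _ _ → β c u ℤ.* β l v))
    (trans (sym (ℤSum.Σ-⊕ del (λ c l _ _ → β c u ℤ.* β l v) (λ c l _ _ → β (suc c) u ℤ.* β l v)))
    (ℤSum.Σ-cong del λ c l _ _ →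
      trans (sym (ℤP.*-distribʳ-+ (β l v) (β c u) (β (suc c) u))) (cong (ℤ._* β l v) (ℤP.+-comm (β c u) _))))

  -- a loop contributes a factor y; (y-1)^(l+1) + (y-1)^l = y (y-1)^l
  tutte-formula-loop : Loop → TutteFormula del → TutteFormula M
  tutte-formula-loop loop IH u zero = begin
    τ M u 0
      ≡⟨ τ-loop loop u 0 ⟩
    ℤSum.Σ[ del ] (λ c l _ _ → β c u ℤ.* (β (suc l) 0 ℤ.+ β l 0))
      ≡⟨ ℤSum.Σ-const del refl _ (λ c l _ _ → trans (cong (β c u ℤ.*_) (β-step-zero l)) (ℤP.*-zeroʳ (β c u))) ⟩
    + 0
      ≡⟨ cong +_ (sym (T-loop-zero loop u)) ⟩
    + T M u 0 ∎
    where open ≡-Reasoning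
  tutte-formula-loop loop IH u (suc v) = begin
    τ M u (suc v)
      ≡⟨ τ-loop loop u (suc v) ⟩
    ℤSum.Σ[ del ] (λ c l _ _ → β c u ℤ.* (β (suc l) (suc v) ℤ.+ β l (suc v)))
      ≡⟨ ℤSum.Σ-cong del (λ c l _ _ → cong (β c u ℤ.*_) (β-step-suc l v)) ⟩
    τ del u v
      ≡⟨ IH u v ⟩
    + T del u v
      ≡⟨ cong +_ (sym (T-loop-suc loop u v)) ⟩
    + T M u (suc v) ∎
    where open ≡-Reasoning

  -- a coloop contributes a factor x
  tutte-formula-coloop : Coloop → TutteFormula del → TutteFormula M
  tutte-formula-coloop coloop IH zero v = begin
    τ M 0 v
      ≡⟨ τ-coloop coloop 0 v ⟩
    ℤSum.Σ[ del ] (λ c l _ _ → (β (suc c) 0 ℤ.+ β c 0) ℤ.* β l v)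
      ≡⟨ ℤSum.Σ-const del refl _ (λ c l _ _ → trans (cong (ℤ._* β l v) (β-step-zero c)) (ℤP.*-zeroˡ (β l v))) ⟩
    + 0
      ≡⟨ cong +_ (sym (T-coloop-zero coloop v)) ⟩
    + T M 0 v ∎
    where open ≡-Reasoning
  tutte-formula-coloop coloop IH (suc u) v = begin
    τ M (suc u) v
      ≡⟨ τ-coloop coloop (suc u) v ⟩
    ℤSum.Σ[ del ] (λ c l _ _ → (β (suc c) (suc u) ℤ.+ β c (suc u)) ℤ.* β l v)
      ≡⟨ ℤSum.Σ-cong del (λ c l _ _ → cong (ℤ._* β l v) (β-step-suc c u)) ⟩
    τ del u v
      ≡⟨ IH u v ⟩
    + T del u v
      ≡⟨ cong +_ (sym (T-coloop-suc coloop u v)) ⟩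
    + T M (suc u) v ∎
    where open ≡-Reasoning

  tutte-formula-generic : ¬ Loop → ¬ Coloop → TutteFormula con → TutteFormula del → TutteFormula M
  tutte-formula-generic ¬loop ¬coloop IH-con IH-del u v = begin
    τ M u v                         ≡⟨ Σ-generic ¬loop ¬coloop (λ c l _ _ → β c u ℤ.* β l v) ⟩
    τ con u v ℤ.+ τ del u v         ≡⟨ cong₂ ℤ._+_ (IH-con u v) (IH-del u v) ⟩
    + T con u v ℤ.+ + T del u v     ≡⟨ sym (ℤP.pos-+ (T con u v) (T del u v)) ⟩
    + (T con u v + T del u v)       ≡⟨ cong +_ (sym (T-generic ¬loop ¬coloop u v)) ⟩
    + T M u v                       ∎
    where open ≡-Reasoning

tutte-formula : ∀ n (M : Matroid n) → TutteFormula M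
tutte-formula zero M = tutte-formula-empty M
tutte-formula (suc n) M with Minors.loop? M | Minors.coloop? M
... | yes loop | _ = TutteFormulaSteps.tutte-formula-loop M loop (tutte-formula n (Minors.del M))
... | no ¬loop | yes coloop = TutteFormulaSteps.tutte-formula-coloop M coloop (tutte-formula n (Minors.del M))
... | no ¬loop | no ¬coloop =
  TutteFormulaSteps.tutte-formula-generic M ¬loop ¬coloop (tutte-formula n (Minors.con M)) (tutte-formula n (Minors.del M))

-- Factorials: the derivative ∂ʲ⁺ᵠ/∂yᵠ turns yʲ⁺ᵠ into (j+1)⋯(j+q) yʲ = q! bin j q yʲ

rising : ℕ → ℕ → ℕ
rising j zero = 1
rising j (suc q) = suc j * rising (suc j) q

rising-factorial : ∀ j q → rising j q * j ! ≡ (j + q) !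
rising-factorial j zero = trans (+-identityʳ (j !)) (cong _! (sym (+-identityʳ j)))
rising-factorial j (suc q) = begin
  suc j * rising (suc j) q * j !   ≡⟨ regroup (rising (suc j) q) j (j !) ⟩
  rising (suc j) q * suc j !       ≡⟨ rising-factorial (suc j) q ⟩
  (suc j + q) !                    ≡⟨ cong _! (sym (+-suc j q)) ⟩
  (j + suc q) !                    ∎
  where
  open ≡-Reasoning
  regroup : ∀ d j f → (suc j * d) * f ≡ d * (suc j * f)
  regroup = solve-∀

bin-factorial : ∀ a b → bin a b * (a ! * b !) ≡ (a + b) !
bin-factorial zero b = trans (+-identityʳ _) (+-identityʳ _)
bin-factorial (suc a) zero = trans (+-identityʳ _) (trans (*-identityʳ _) (cong _! (sym (+-identityʳ (suc a)))))
bin-factorial (suc a) (suc b) = begin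
  (bin a (suc b) + bin (suc a) b) * (suc a ! * suc b !)
    ≡⟨ split (bin a (suc b)) (bin (suc a) b) a b (a !) (b !) ⟩
  suc a * (bin a (suc b) * (a ! * suc b !)) + suc b * (bin (suc a) b * (suc a ! * b !))
    ≡⟨ cong₂ (λ u v → suc a * u + suc b * v)
             (bin-factorial a (suc b)) (trans (bin-factorial (suc a) b) (cong _! (sym (+-suc a b)))) ⟩
  suc a * (a + suc b) ! + suc b * (a + suc b) !
    ≡⟨ merge a b ((a + suc b) !) ⟩
  (suc a + suc b) ! ∎
  where
  open ≡-Reasoning
  split : ∀ x y a b fa fb → (x + y) * ((suc a * fa) * (suc b * fb))
                           ≡ suc a * (x * (fa * (suc b * fb))) + suc b * (y * ((suc a * fa) * fb))
  split = solve-∀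
  merge : ∀ a b m → suc a * m + suc b * m ≡ suc (a + suc b) * m
  merge = solve-∀

rising≡ : ∀ j q → rising j q ≡ q ! * bin j q
rising≡ j q = *-cancelʳ-≡ (rising j q) (q ! * bin j q) (j !) {{j !≢0}} (begin
  rising j q * j !         ≡⟨ rising-factorial j q ⟩
  (j + q) !                ≡⟨ sym (bin-factorial j q) ⟩
  bin j q * (j ! * q !)    ≡⟨ regroup (bin j q) (j !) (q !) ⟩
  q ! * bin j q * j !      ∎)
  where
  open ≡-Reasoning
  regroup : ∀ b fj fq → b * (fj * fq) ≡ fq * b * fj
  regroup = solve-∀

bin-sym : ∀ a b → bin a b ≡ bin b a
bin-sym a b = *-cancelʳ-≡ (bin a b) (bin b a) (a ! * b !) {{a !* b !≢0}} (begin
  bin a b * (a ! * b !)    ≡⟨ bin-factorial a b ⟩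
  (a + b) !                ≡⟨ cong _! (+-comm a b) ⟩
  (b + a) !                ≡⟨ sym (bin-factorial b a) ⟩
  bin b a * (b ! * a !)    ≡⟨ cong (bin b a *_) (*-comm (b !) (a !)) ⟩
  bin b a * (a ! * b !)    ∎)
  where open ≡-Reasoning

Σ≤-cong : ∀ m {f g : ℕ → ℤ} → (∀ k → f k ≡ g k) → Σ≤ m f ≡ Σ≤ m g
Σ≤-cong zero f≗g = f≗g 0
Σ≤-cong (suc m) f≗g = cong₂ ℤ._+_ (Σ≤-cong m f≗g) (f≗g (suc m))

Σ≤-zero : ∀ m {f : ℕ → ℤ} → (∀ k → f k ≡ + 0) → Σ≤ m f ≡ + 0
Σ≤-zero zero f≡0 = f≡0 0
Σ≤-zero (suc m) f≡0 = cong₂ ℤ._+_ (Σ≤-zero m f≡0) (f≡0 (suc m))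

Σ≤-first : ∀ m {f : ℕ → ℤ} → (∀ k → f (suc k) ≡ + 0) → Σ≤ m f ≡ f 0
Σ≤-first zero _ = refl
Σ≤-first (suc m) {f} f≡0 = trans (cong₂ ℤ._+_ (Σ≤-first m f≡0) (f≡0 m)) (ℤP.+-identityʳ (f 0))

Σ≤-last : ∀ m {f : ℕ → ℤ} → (∀ k → k < m → f k ≡ + 0) → Σ≤ m f ≡ f m
Σ≤-last zero _ = refl
Σ≤-last (suc m) {f} f≡0 = trans (cong (ℤ._+ f (suc m))
  (trans (Σ≤-last m (λ k k<m → f≡0 k (m<n⇒m<1+n k<m))) (f≡0 m (n<1+n m)))) (ℤP.+-identityˡ _)

Σ≤-shift : ∀ m (f : ℕ → ℤ) → Σ≤ (suc m) f ≡ f 0 ℤ.+ Σ≤ m (f ∘ suc)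
Σ≤-shift zero f = refl
Σ≤-shift (suc m) f = trans (cong (ℤ._+ f (suc (suc m))) (Σ≤-shift m f)) (ℤP.+-assoc (f 0) _ _)

XOnly YOnly : Poly → Set
XOnly P = ∀ i j → P i (suc j) ≡ + 0
YOnly P = ∀ i j → P (suc i) j ≡ + 0

*P-XOnly : ∀ {P Q} → XOnly P → XOnly Q → XOnly (P *P Q)
*P-XOnly {P} {Q} P-x Q-x i j = Σ≤-zero i λ a → Σ≤-zero (suc j) λ where
  zero → trans (cong (P a 0 ℤ.*_) (Q-x (i ∸ a) j)) (ℤP.*-zeroʳ (P a 0))
  (suc b) → trans (cong (ℤ._* Q (i ∸ a) (j ∸ b)) (P-x a b)) (ℤP.*-zeroˡ (Q (i ∸ a) (j ∸ b)))

*P-YOnly : ∀ {P Q} → YOnly P → YOnly Q → YOnly (P *P Q)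
*P-YOnly {P} {Q} P-y Q-y i j = Σ≤-zero (suc i) λ where
  zero → Σ≤-zero j λ b → trans (cong (P 0 b ℤ.*_) (Q-y i (j ∸ b))) (ℤP.*-zeroʳ (P 0 b))
  (suc a) → Σ≤-zero j λ b → trans (cong (ℤ._* Q (i ∸ a) (j ∸ b)) (P-y a b)) (ℤP.*-zeroˡ (Q (i ∸ a) (j ∸ b)))

^P-XOnly : ∀ {P} → XOnly P → ∀ a → XOnly (P ^P a)
^P-XOnly P-x zero zero j = refl
^P-XOnly P-x zero (suc i) j = refl
^P-XOnly {P} P-x (suc a) = *P-XOnly {P} {P ^P a} P-x (^P-XOnly P-x a)

^P-YOnly : ∀ {P} → YOnly P → ∀ a → YOnly (P ^P a)
^P-YOnly P-y zero i j = refl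
^P-YOnly {P} P-y (suc a) = *P-YOnly {P} {P ^P a} P-y (^P-YOnly P-y a)

product-separates : ∀ {P Q} → XOnly P → YOnly Q → ∀ i j → (P *P Q) i j ≡ P i 0 ℤ.* Q 0 j
product-separates {P} {Q} P-x Q-y i j =
  trans (Σ≤-cong i (λ a → Σ≤-first j (λ k → trans (cong (ℤ._* Q (i ∸ a) (j ∸ suc k)) (P-x a k))
                                                   (ℤP.*-zeroˡ (Q (i ∸ a) (j ∸ suc k))))))
  (trans (Σ≤-last i below) (cong (λ z → P i 0 ℤ.* Q z j) (n∸n≡0 i)))
  where
  below : ∀ k → k < i → P k 0 ℤ.* Q (i ∸ k) j ≡ + 0
  below k k<i with i ∸ k | m>n⇒m∸n≢0 k<i
  ... | zero | i∸k≢0 = contradiction refl i∸k≢0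
  ... | suc t | _ = trans (cong (P k 0 ℤ.*_) (Q-y t j)) (ℤP.*-zeroʳ (P k 0))

linear-*P : ∀ {P} → (∀ k → P (suc (suc k)) 0 ≡ + 0) → ∀ Q i →
  (P *P Q) (suc i) 0 ≡ P 0 0 ℤ.* Q (suc i) 0 ℤ.+ P 1 0 ℤ.* Q i 0
linear-*P {P} P-linear Q i = trans (Σ≤-shift i (λ k → P k 0 ℤ.* Q (suc i ∸ k) 0))
  (cong (λ z → P 0 0 ℤ.* Q (suc i) 0 ℤ.+ z)
        (Σ≤-first i (λ k → trans (cong (ℤ._* Q (i ∸ suc k) 0) (P-linear k)) (ℤP.*-zeroˡ (Q (i ∸ suc k) 0)))))

linear-*Pʸ : ∀ {P} → (∀ k → P 0 (suc (suc k)) ≡ + 0) → ∀ Q j →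
  (P *P Q) 0 (suc j) ≡ P 0 0 ℤ.* Q 0 (suc j) ℤ.+ P 0 1 ℤ.* Q 0 j
linear-*Pʸ {P} P-linear Q j = trans (Σ≤-shift j (λ k → P 0 k ℤ.* Q 0 (suc j ∸ k)))
  (cong (λ z → P 0 0 ℤ.* Q 0 (suc j) ℤ.+ z)
        (Σ≤-first j (λ k → trans (cong (ℤ._* Q 0 (j ∸ suc k)) (P-linear k)) (ℤP.*-zeroˡ (Q 0 (j ∸ suc k))))))

X-1 Y-1 : Poly
X-1 = X -P constP (+ 1)
Y-1 = Y -P constP (+ 1)

X-XOnly : XOnly X
X-XOnly zero j = refl
X-XOnly (suc zero) j = refl
X-XOnly (suc (suc i)) j = refl

X-1-XOnly : XOnly X-1
X-1-XOnly zero j = refl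
X-1-XOnly (suc zero) j = refl
X-1-XOnly (suc (suc i)) j = refl

Y-YOnly : YOnly Y
Y-YOnly i j = refl

Y-1-YOnly : YOnly Y-1
Y-1-YOnly i j = refl

x-power : ∀ a i → (X ^P a) i 0 ≡ + kron a i
x-power zero zero = refl
x-power zero (suc i) = refl
x-power (suc a) zero = ℤP.*-zeroˡ ((X ^P a) 0 0)
x-power (suc a) (suc i) = begin
  (X *P X ^P a) (suc i) 0
    ≡⟨ linear-*P {X} (λ _ → refl) (X ^P a) i ⟩
  + 0 ℤ.* (X ^P a) (suc i) 0 ℤ.+ + 1 ℤ.* (X ^P a) i 0
    ≡⟨ cong₂ ℤ._+_ (ℤP.*-zeroˡ ((X ^P a) (suc i) 0)) (ℤP.*-identityˡ ((X ^P a) i 0)) ⟩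
  + 0 ℤ.+ (X ^P a) i 0
    ≡⟨ ℤP.+-identityˡ _ ⟩
  (X ^P a) i 0
    ≡⟨ x-power a i ⟩
  + kron a i ∎
  where open ≡-Reasoning

y-power : ∀ b j → (Y ^P b) 0 j ≡ + kron b j
y-power zero zero = refl
y-power zero (suc j) = refl
y-power (suc b) zero = ℤP.*-zeroˡ ((Y ^P b) 0 0)
y-power (suc b) (suc j) = begin
  (Y *P Y ^P b) 0 (suc j)
    ≡⟨ linear-*Pʸ {Y} (λ _ → refl) (Y ^P b) j ⟩
  + 0 ℤ.* (Y ^P b) 0 (suc j) ℤ.+ + 1 ℤ.* (Y ^P b) 0 j
    ≡⟨ cong₂ ℤ._+_ (ℤP.*-zeroˡ ((Y ^P b) 0 (suc j))) (ℤP.*-identityˡ ((Y ^P b) 0 j)) ⟩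
  + 0 ℤ.+ (Y ^P b) 0 j
    ≡⟨ ℤP.+-identityˡ _ ⟩
  (Y ^P b) 0 j
    ≡⟨ y-power b j ⟩
  + kron b j ∎
  where open ≡-Reasoning

x-1-power : ∀ a i → (X-1 ^P a) i 0 ≡ β a i
x-1-power zero zero = refl
x-1-power zero (suc i) = refl
x-1-power (suc a) zero = trans (ℤP.-1*i≡-i _) (cong -_ (x-1-power a 0))
x-1-power (suc a) (suc i) = begin
  (X-1 *P X-1 ^P a) (suc i) 0
    ≡⟨ linear-*P {X-1} (λ _ → refl) (X-1 ^P a) i ⟩
  - + 1 ℤ.* (X-1 ^P a) (suc i) 0 ℤ.+ + 1 ℤ.* (X-1 ^P a) i 0
    ≡⟨ cong₂ ℤ._+_ (ℤP.-1*i≡-i ((X-1 ^P a) (suc i) 0)) (ℤP.*-identityˡ ((X-1 ^P a) i 0)) ⟩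
  - (X-1 ^P a) (suc i) 0 ℤ.+ (X-1 ^P a) i 0
    ≡⟨ cong₂ (λ u v → - u ℤ.+ v) (x-1-power a (suc i)) (x-1-power a i) ⟩
  - β a (suc i) ℤ.+ β a i
    ≡⟨ ℤP.+-comm (- β a (suc i)) (β a i) ⟩
  β (suc a) (suc i) ∎
  where open ≡-Reasoning

y-1-power : ∀ b j → (Y-1 ^P b) 0 j ≡ β b j
y-1-power zero zero = refl
y-1-power zero (suc j) = refl
y-1-power (suc b) zero = trans (ℤP.-1*i≡-i _) (cong -_ (y-1-power b 0))
y-1-power (suc b) (suc j) = begin
  (Y-1 *P Y-1 ^P b) 0 (suc j)
    ≡⟨ linear-*Pʸ {Y-1} (λ _ → refl) (Y-1 ^P b) j ⟩
  - + 1 ℤ.* (Y-1 ^P b) 0 (suc j) ℤ.+ + 1 ℤ.* (Y-1 ^P b) 0 j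
    ≡⟨ cong₂ ℤ._+_ (ℤP.-1*i≡-i ((Y-1 ^P b) 0 (suc j))) (ℤP.*-identityˡ ((Y-1 ^P b) 0 j)) ⟩
  - (Y-1 ^P b) 0 (suc j) ℤ.+ (Y-1 ^P b) 0 j
    ≡⟨ cong₂ (λ u v → - u ℤ.+ v) (y-1-power b (suc j)) (y-1-power b j) ⟩
  - β b (suc j) ℤ.+ β b j
    ≡⟨ ℤP.+-comm (- β b (suc j)) (β b j) ⟩
  β (suc b) (suc j) ∎
  where open ≡-Reasoning

monomial-coef : ∀ a b i j → (X ^P a *P Y ^P b) i j ≡ + kron a i ℤ.* + kron b j
monomial-coef a b i j = trans (product-separates {X ^P a} {Y ^P b} (^P-XOnly X-XOnly a) (^P-YOnly Y-YOnly b) i j)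
                              (cong₂ ℤ._*_ (x-power a i) (y-power b j))

tutte-term-coef : ∀ a b i j → (X-1 ^P a *P Y-1 ^P b) i j ≡ β a i ℤ.* β b j
tutte-term-coef a b i j = trans (product-separates {X-1 ^P a} {Y-1 ^P b} (^P-XOnly X-1-XOnly a) (^P-YOnly Y-1-YOnly b) i j)
                                (cong₂ ℤ._*_ (x-1-power a i) (y-1-power b j))

Σ-list : ∀ {C : Set} → (C → ℤ) → List C → ℤ
Σ-list h [] = + 0
Σ-list h (x ∷ L) = h x ℤ.+ Σ-list h L

sumP-coef : ∀ {C : Set} (f : C → Poly) (L : List C) i j → sumP (List.map f L) i j ≡ Σ-list (λ A → f A i j) L
sumP-coef f [] i j = refl
sumP-coef f (x ∷ L) i j = cong (λ z → f x i j ℤ.+ z) (sumP-coef f L i j)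

restrict : ∀ {P : Set} → Dec P → ℤ → ℤ
restrict (yes _) x = x
restrict (no _) x = + 0

Σ-list-filter : ∀ {C : Set} {P : Pred C 0ℓ} (P? : Decidable P) (h : C → ℤ) (L : List C) →
  Σ-list h (filter P? L) ≡ Σ-list (λ A → restrict (P? A) (h A)) L
Σ-list-filter P? h [] = refl
Σ-list-filter P? h (x ∷ L) with P? x
... | yes _ = cong (λ z → h x ℤ.+ z) (Σ-list-filter P? h L)
... | no _ = trans (Σ-list-filter P? h L) (sym (ℤP.+-identityˡ _))

Σ-list-++ : ∀ {C : Set} (h : C → ℤ) (L₁ L₂ : List C) → Σ-list h (L₁ ++ L₂) ≡ Σ-list h L₁ ℤ.+ Σ-list h L₂
Σ-list-++ h [] L₂ = sym (ℤP.+-identityˡ _)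
Σ-list-++ h (x ∷ L₁) L₂ = trans (cong (λ z → h x ℤ.+ z) (Σ-list-++ h L₁ L₂)) (sym (ℤP.+-assoc (h x) _ _))

Σ-list-map : ∀ {C D : Set} (h : D → ℤ) (g : C → D) (L : List C) → Σ-list h (List.map g L) ≡ Σ-list (h ∘ g) L
Σ-list-map h g [] = refl
Σ-list-map h g (x ∷ L) = cong (λ z → h (g x) ℤ.+ z) (Σ-list-map h g L)

-- allSubsets lists each subset once, so its sum is the subset sum
Σ-list-allSubsets : ∀ n (h : Subset n → ℤ) → Σ-list h (allSubsets n) ≡ ℤSum.sumS n h
Σ-list-allSubsets zero h = ℤP.+-identityʳ (h [])
Σ-list-allSubsets (suc n) h = begin
  Σ-list h (List.map (inside ∷_) (allSubsets n) ++ List.map (outside ∷_) (allSubsets n))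
    ≡⟨ Σ-list-++ h (List.map (inside ∷_) (allSubsets n)) _ ⟩
  Σ-list h (List.map (inside ∷_) (allSubsets n)) ℤ.+ Σ-list h (List.map (outside ∷_) (allSubsets n))
    ≡⟨ cong₂ ℤ._+_ (trans (Σ-list-map h _ (allSubsets n)) (Σ-list-allSubsets n _))
                   (trans (Σ-list-map h _ (allSubsets n)) (Σ-list-allSubsets n _)) ⟩
  ℤSum.sumS (suc n) h ∎
  where open ≡-Reasoning

sumOver-coef : ∀ {n} {P : Pred (Subset n) 0ℓ} (P? : Decidable P) (f : Subset n → Poly) i j →
  sumOver P? f i j ≡ ℤSum.sumS n (λ A → restrict (P? A) (f A i j))
sumOver-coef {n} P? f i j = begin
  sumOver P? f i j                                           ≡⟨ sumP-coef f (filter P? (allSubsets n)) i j ⟩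
  Σ-list (λ A → f A i j) (filter P? (allSubsets n))          ≡⟨ Σ-list-filter P? (λ A → f A i j) (allSubsets n) ⟩
  Σ-list (λ A → restrict (P? A) (f A i j)) (allSubsets n)    ≡⟨ Σ-list-allSubsets n _ ⟩
  ℤSum.sumS n (λ A → restrict (P? A) (f A i j))              ∎
  where open ≡-Reasoning

sumS-pos : ∀ n (f : Subset n → ℕ) → ℤSum.sumS n (λ A → + f A) ≡ + ℕSum.sumS n f
sumS-pos zero f = refl
sumS-pos (suc n) f = trans (cong₂ ℤ._+_ (sumS-pos n _) (sumS-pos n _))
                           (sym (ℤP.pos-+ (ℕSum.sumS n (f ∘ (true ∷_))) (ℕSum.sumS n (f ∘ (false ∷_)))))

tutte-coef : ∀ {n} (M : Matroid n) u v → tutte M u v ≡ + T M u v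
tutte-coef {n} M u v = begin
  tutte M u v
    ≡⟨ sumP-coef _ (allSubsets n) u v ⟩
  Σ-list (λ A → (X-1 ^P cr M A *P Y-1 ^P nl M A) u v) (allSubsets n)
    ≡⟨ Σ-list-allSubsets n _ ⟩
  ℤSum.sumS n (λ A → (X-1 ^P cr M A *P Y-1 ^P nl M A) u v)
    ≡⟨ ℤSum.sumS-cong n (λ A → tutte-term-coef (cr M A) (nl M A) u v) ⟩
  τ M u v
    ≡⟨ tutte-formula n M u v ⟩
  + T M u v ∎
  where open ≡-Reasoning

iter-∂y-coef : ∀ q P i j → iter q ∂y P i j ≡ + rising j q ℤ.* P i (j + q)
iter-∂y-coef zero P i j = trans (sym (ℤP.*-identityˡ _)) (cong (λ z → + 1 ℤ.* P i z) (sym (+-identityʳ j)))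
iter-∂y-coef (suc q) P i j = begin
  + suc j ℤ.* iter q ∂y P i (suc j)
    ≡⟨ cong (+ suc j ℤ.*_) (iter-∂y-coef q P i (suc j)) ⟩
  + suc j ℤ.* (+ rising (suc j) q ℤ.* P i (suc j + q))
    ≡⟨ sym (ℤP.*-assoc (+ suc j) (+ rising (suc j) q) (P i (suc j + q))) ⟩
  + suc j ℤ.* + rising (suc j) q ℤ.* P i (suc j + q)
    ≡⟨ cong₂ ℤ._*_ (sym (ℤP.pos-* (suc j) (rising (suc j) q))) (cong (P i) (sym (+-suc j q))) ⟩
  + rising j (suc q) ℤ.* P i (j + suc q) ∎
  where open ≡-Reasoning

iter-∂x-coef : ∀ p P i j → iter p ∂x P i j ≡ + rising i p ℤ.* P (i + p) j
iter-∂x-coef zero P i j = trans (sym (ℤP.*-identityˡ _)) (cong (λ z → + 1 ℤ.* P z j) (sym (+-identityʳ i)))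
iter-∂x-coef (suc p) P i j = begin
  + suc i ℤ.* iter p ∂x P (suc i) j
    ≡⟨ cong (+ suc i ℤ.*_) (iter-∂x-coef p P (suc i) j) ⟩
  + suc i ℤ.* (+ rising (suc i) p ℤ.* P (suc i + p) j)
    ≡⟨ sym (ℤP.*-assoc (+ suc i) (+ rising (suc i) p) (P (suc i + p) j)) ⟩
  + suc i ℤ.* + rising (suc i) p ℤ.* P (suc i + p) j
    ≡⟨ cong₂ ℤ._*_ (sym (ℤP.pos-* (suc i) (rising (suc i) p))) (cong (λ z → P z j) (sym (+-suc i p))) ⟩
  + rising i (suc p) ℤ.* P (i + suc p) j ∎
  where open ≡-Reasoning

∂^-coef : ∀ p q P i j → ∂^ p q P i j ≡ + (rising i p * rising j q) ℤ.* P (i + p) (j + q)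
∂^-coef p q P i j = begin
  iter p ∂x (iter q ∂y P) i j
    ≡⟨ iter-∂x-coef p (iter q ∂y P) i j ⟩
  + rising i p ℤ.* iter q ∂y P (i + p) j
    ≡⟨ cong (+ rising i p ℤ.*_) (iter-∂y-coef q P (i + p) j) ⟩
  + rising i p ℤ.* (+ rising j q ℤ.* P (i + p) (j + q))
    ≡⟨ sym (ℤP.*-assoc (+ rising i p) (+ rising j q) (P (i + p) (j + q))) ⟩
  + rising i p ℤ.* + rising j q ℤ.* P (i + p) (j + q)
    ≡⟨ cong (ℤ._* P (i + p) (j + q)) (sym (ℤP.pos-* (rising i p) (rising j q))) ⟩
  + (rising i p * rising j q) ℤ.* P (i + p) (j + q) ∎
  where open ≡-Reasoning

kron-refl : ∀ x → kron x x ≡ 1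
kron-refl zero = refl
kron-refl (suc x) = kron-refl x

kron-≢ : ∀ x y → x ≢ y → kron x y ≡ 0
kron-≢ zero zero x≢y = contradiction refl x≢y
kron-≢ zero (suc y) _ = refl
kron-≢ (suc x) zero _ = refl
kron-≢ (suc x) (suc y) x≢y = kron-≢ x y (x≢y ∘ cong suc)

restrict-kron : ∀ x p y q z → restrict ((x ≟ p) ×-dec (y ≟ q)) z ≡ + (kron x p * kron y q) ℤ.* z
restrict-kron x p y q z with x ≟ p | y ≟ q
... | yes refl | yes refl rewrite kron-refl x | kron-refl y = sym (ℤP.*-identityˡ z)
... | yes refl | no y≢q rewrite kron-≢ y q y≢q | *-zeroʳ (kron x x) = sym (ℤP.*-zeroˡ z)
... | no x≢p | _ rewrite kron-≢ x p x≢p = sym (ℤP.*-zeroˡ z)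

count-with : ∀ {n} (s t f g : Subset n → ℕ) → ℕ → ℕ → ℕ → ℕ → ℕ
count-with {n} s t f g p q i j = ℕSum.sumS n (λ A → kron (s A) p * kron (t A) q * (kron (f A) i * kron (g A) j))

monomial-sum-coef : ∀ {n} (s t f g : Subset n → ℕ) k p q i j →
  ((+ k) ·P sumOver (λ A → (s A ≟ p) ×-dec (t A ≟ q)) (λ A → X ^P f A *P Y ^P g A)) i j
  ≡ + (k * count-with s t f g p q i j)
monomial-sum-coef {n} s t f g k p q i j = begin
  + k ℤ.* sumOver (λ A → (s A ≟ p) ×-dec (t A ≟ q)) (λ A → X ^P f A *P Y ^P g A) i j
    ≡⟨ cong (+ k ℤ.*_) (trans (sumOver-coef (λ A → (s A ≟ p) ×-dec (t A ≟ q)) (λ A → X ^P f A *P Y ^P g A) i j)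
                               (ℤSum.sumS-cong n term)) ⟩
  + k ℤ.* ℤSum.sumS n (λ A → + (kron (s A) p * kron (t A) q * (kron (f A) i * kron (g A) j)))
    ≡⟨ cong (+ k ℤ.*_) (sumS-pos n _) ⟩
  + k ℤ.* + count-with s t f g p q i j
    ≡⟨ sym (ℤP.pos-* k _) ⟩
  + (k * count-with s t f g p q i j) ∎
  where
  open ≡-Reasoning
  term : ∀ A → restrict ((s A ≟ p) ×-dec (t A ≟ q)) ((X ^P f A *P Y ^P g A) i j)
             ≡ + (kron (s A) p * kron (t A) q * (kron (f A) i * kron (g A) j))
  term A = begin
    restrict ((s A ≟ p) ×-dec (t A ≟ q)) ((X ^P f A *P Y ^P g A) i j)
      ≡⟨ restrict-kron (s A) p (t A) q _ ⟩
    + (kron (s A) p * kron (t A) q) ℤ.* (X ^P f A *P Y ^P g A) i j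
      ≡⟨ cong (+ (kron (s A) p * kron (t A) q) ℤ.*_) (monomial-coef (f A) (g A) i j) ⟩
    + (kron (s A) p * kron (t A) q) ℤ.* (+ kron (f A) i ℤ.* + kron (g A) j)
      ≡⟨ cong (+ (kron (s A) p * kron (t A) q) ℤ.*_) (sym (ℤP.pos-* (kron (f A) i) (kron (g A) j))) ⟩
    + (kron (s A) p * kron (t A) q) ℤ.* + (kron (f A) i * kron (g A) j)
      ≡⟨ sym (ℤP.pos-* (kron (s A) p * kron (t A) q) _) ⟩
    + (kron (s A) p * kron (t A) q * (kron (f A) i * kron (g A) j)) ∎

derivative-formula : ∀ {n} (M : Matroid n) p q (s t f g : Subset n → ℕ) →
  (∀ i j → count-with s t f g p q i j ≡ bin i p * bin j q * T M (i + p) (j + q)) →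
  ∂^ p q (tutte M) ≈P (+ (p ! * q !)) ·P sumOver (λ A → (s A ≟ p) ×-dec (t A ≟ q)) (λ A → X ^P f A *P Y ^P g A)
derivative-formula M p q s t f g counted i j = begin
  ∂^ p q (tutte M) i j
    ≡⟨ ∂^-coef p q (tutte M) i j ⟩
  + (rising i p * rising j q) ℤ.* tutte M (i + p) (j + q)
    ≡⟨ cong (+ (rising i p * rising j q) ℤ.*_) (tutte-coef M (i + p) (j + q)) ⟩
  + (rising i p * rising j q) ℤ.* + T M (i + p) (j + q)
    ≡⟨ sym (ℤP.pos-* (rising i p * rising j q) _) ⟩
  + (rising i p * rising j q * T M (i + p) (j + q))
    ≡⟨ cong +_ (cong₂ (λ a b → a * b * T M (i + p) (j + q)) (rising≡ i p) (rising≡ j q)) ⟩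
  + (p ! * bin i p * (q ! * bin j q) * T M (i + p) (j + q))
    ≡⟨ cong +_ (regroup (p !) (q !) (bin i p) (bin j q) _) ⟩
  + (p ! * q ! * (bin i p * bin j q * T M (i + p) (j + q)))
    ≡⟨ cong (λ c → + (p ! * q ! * c)) (sym (counted i j)) ⟩
  + (p ! * q ! * count-with s t f g p q i j)
    ≡⟨ sym (monomial-sum-coef s t f g (p ! * q !) p q i j) ⟩
  _ ∎
  where
  open ≡-Reasoning
  regroup : ∀ a b c d t → a * c * (b * d) * t ≡ a * b * (c * d * t)
  regroup = solve-∀

module _ {n : ℕ} (M : Matroid n) (p q i j : ℕ) where
  open ≡-Reasoning

  count-ι-nl : count-with (ι M) (nl M) (cr M) (ε M) p q i j ≡ bin i p * bin j q * T M (i + p) (j + q)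
  count-ι-nl = begin
    count-with (ι M) (nl M) (cr M) (ε M) p q i j
      ≡⟨ ℕSum.sumS-cong n (λ A → reorder (kron (ι M A) p) (kron (nl M A) q) (kron (cr M A) i) (kron (ε M A) j)) ⟩
    N M i q p j
      ≡⟨ count-formula n M i q p j ⟩
    bin i p * bin q j * T M (i + p) (q + j)
      ≡⟨ cong₂ (λ b m → bin i p * b * T M (i + p) m) (bin-sym q j) (+-comm q j) ⟩
    bin i p * bin j q * T M (i + p) (j + q) ∎
    where
    reorder : ∀ a b c d → a * b * (c * d) ≡ c * (b * (a * d))
    reorder = solve-∀

  count-cr-ε : count-with (cr M) (ε M) (ι M) (nl M) p q i j ≡ bin i p * bin j q * T M (i + p) (j + q)
  count-cr-ε = begin
    count-with (cr M) (ε M) (ι M) (nl M) p q i j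
      ≡⟨ ℕSum.sumS-cong n (λ A → reorder (kron (cr M A) p) (kron (ε M A) q) (kron (ι M A) i) (kron (nl M A) j)) ⟩
    N M p j i q
      ≡⟨ count-formula n M p j i q ⟩
    bin p i * bin j q * T M (p + i) (j + q)
      ≡⟨ cong₂ (λ b k → b * bin j q * T M k (j + q)) (bin-sym p i) (+-comm p i) ⟩
    bin i p * bin j q * T M (i + p) (j + q) ∎
    where
    reorder : ∀ a b c d → a * b * (c * d) ≡ a * (d * (c * b))
    reorder = solve-∀

  count-ι-ε : count-with (ι M) (ε M) (cr M) (nl M) p q i j ≡ bin i p * bin j q * T M (i + p) (j + q)
  count-ι-ε = begin
    count-with (ι M) (ε M) (cr M) (nl M) p q i j
      ≡⟨ ℕSum.sumS-cong n (λ A → reorder (kron (ι M A) p) (kron (ε M A) q) (kron (cr M A) i) (kron (nl M A) j)) ⟩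
    N M i j p q                                    ≡⟨ count-formula n M i j p q ⟩
    bin i p * bin j q * T M (i + p) (j + q)        ∎
    where
    reorder : ∀ a b c d → a * b * (c * d) ≡ c * (d * (a * b))
    reorder = solve-∀

corollary1 : ∀ {n} (M : Matroid n) (p q : ℕ) →
    (∂^ p q (tutte M) ≈P (+ (p ! * q !)) ·P sumOver (λ A → (ι M A ≟ p) ×-dec (nl M A ≟ q)) (λ A → X ^P cr M A *P Y ^P ε M A))
    × (∂^ p q (tutte M) ≈P (+ (p ! * q !)) ·P sumOver (λ A → (cr M A ≟ p) ×-dec (ε M A ≟ q)) (λ A → X ^P ι M A *P Y ^P nl M A))
    × (∂^ p q (tutte M) ≈P (+ (p ! * q !)) ·P sumOver (λ A → (ι M A ≟ p) ×-dec (ε M A ≟ q)) (λ A → X ^P cr M A *P Y ^P nl M A))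
corollary1 M p q =
    derivative-formula M p q (ι M) (nl M) (cr M) (ε M) (count-ι-nl M p q)
  , derivative-formula M p q (cr M) (ε M) (ι M) (nl M) (count-cr-ε M p q)
  , derivative-formula M p q (ι M) (ε M) (cr M) (nl M) (count-ι-ε M p q)
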